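{- For all integers $l, m, n \geq 0$, \[ \mathscr{D}_{2m}^{(-2l)}(n)=\mathscr{D}_{2l}^{(-2m)}(n), \] where $\mathscr{D}_m^{(-l)}(n)$ denotes the symmetrized polycosecant numbers defined in the context.
   Context: For $k\in\mathbb{Z}$ and $|z|<1$, the polylogarithm is $\mathrm{Li}_k(z)=\sum_{n=1}^{\infty} z^n/n^k$; for $k\le 0$ it is a rational function of $z$. The unsigned Stirling numbers of the first kind $\left[{n\atop j}\right]$ are defined by $x(x+1)\cdots(x+n-1)=\sum_{j=0}^{n}\left[{n\atop j}\right]x^j$, with $\left[{0\atop 0}\right]=1$. For integers $l,n\ge 0$, define numbers $D_m^{(-l)}(n)$ ($m\ge 0$) by the generating function \[ \frac{1}{2}(e^t+1)^{1-n}\frac{\mathrm{Li}_{ -l}(\tanh(t/2))}{\sinh t}+\frac{1}{2}(e^{ -t}+1)^{1-n}\frac{\mathrm{Li}_{ -l}(-\tanh(t/2))}{\sinh(-t)}=\sum_{m=0}^{\infty}D_m^{(-l)}(n)\frac{t^m}{m!}. \] The symmetrized polycosecant numbers are \[ \mathscr{D}_m^{(-l)}(n)=\sum_{j=0}^{n}\left[{n\atop j}\right]D_m^{(-l-j)}(n). \] -}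

module Defs where

open import Data.Nat as ℕ using (ℕ; zero; suc; _!)
open import Data.Nat.Properties using (_!≢0)
open import Data.Integer as ℤ using (+_)
open import Data.Rational as ℚ using (ℚ; 0ℚ; 1ℚ; _+_; _*_; -_; _-_; 1/_; _/_)

infixr 8 _^ℚ_
_^ℚ_ : ℚ → ℕ → ℚ
q ^ℚ zero  = 1ℚ
q ^ℚ suc k = q * (q ^ℚ k)

ℕ→ℚ : ℕ → ℚ
ℕ→ℚ n = (+ n) / 1

sumTo : ℕ → (ℕ → ℚ) → ℚ
sumTo zero    f = f 0
sumTo (suc k) f = sumTo k f + f (suc k)

-- formal power series: k ↦ coefficient of t^k
PS : Set
PS = ℕ → ℚ

oneS : PS
oneS zero    = 1ℚ
oneS (suc _) = 0ℚ

_+S_ : PS → PS → PS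
(f +S g) k = f k + g k

_·S_ : ℚ → PS → PS
(c ·S f) k = c * f k

_*S_ : PS → PS → PS
(f *S g) k = sumTo k (λ i → f i * g (k ℕ.∸ i))

powS : PS → ℕ → PS
powS f zero    = oneS
powS f (suc j) = f *S powS f j

-- composition  a(u(t)) = Σ_j a_j u(t)^j  for a series u with u 0 = 0
-- (then u^j has order ≥ j, so the coefficient of t^k only involves j ≤ k)
compose : (ℕ → ℚ) → PS → PS
compose a u k = sumTo k (λ j → a j * powS u j k)

-- multiplicative inverse of f with f 0 ≠ 0:
-- 1/f = (1/f₀) Σ_j (1 - f/f₀)^j
invS : (f : PS) → .{{_ : ℚ.NonZero (f 0)}} → PS
invS f = (1/ f 0) ·S compose (λ _ → 1ℚ) h
  where
  h : PS
  h zero    = 0ℚ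
  h (suc k) = - (f (suc k) * 1/ f 0)

-- f(t) ↦ f(t)/t, for f with f 0 = 0
divT : PS → PS
divT f k = f (suc k)

scaleS : ℚ → PS → PS
scaleS c f k = (c ^ℚ k) * f k

negS : PS → PS
negS = scaleS (- 1ℚ)

expS : PS
expS k = (+ 1) / (k !) where instance _ = k !≢0

sinhS : PS
sinhS = (1/ ((+ 2) / 1)) ·S (expS +S ((- 1ℚ) ·S negS expS))

coshS : PS
coshS = (1/ ((+ 2) / 1)) ·S (expS +S negS expS)

tanhHalfS : PS
tanhHalfS = scaleS (1/ ((+ 2) / 1)) sinhS *S invS (scaleS (1/ ((+ 2) / 1)) coshS)

-- Li_{-l}(z) = Σ_{n≥1} n^l z^n, as a series to be composed with u, u 0 = 0
liCoeff : ℕ → ℕ → ℚ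
liCoeff l zero    = 0ℚ
liCoeff l (suc j) = ℕ→ℚ (suc j ℕ.^ l)

LiS : ℕ → PS → PS
LiS l u = compose (liCoeff l) u

expP1 : PS
expP1 = expS +S oneS

-- (e^t + 1)^{1-n}
expP1Pow1m : ℕ → PS
expP1Pow1m zero    = expP1
expP1Pow1m (suc k) = powS (invS expP1) k

-- F(t) = (e^t+1)^{1-n} Li_{-l}(tanh(t/2)) / sinh t
-- (division by sinh t: both numerator and sinh t have zero constant term,
--  so  A/sinh t = (A/t) · (sinh t / t)^{-1})
polycscF : ℕ → ℕ → PS
polycscF l n = expP1Pow1m n *S (divT (LiS l tanhHalfS) *S invS (divT sinhS))

-- the generating function  ½ F(t) + ½ F(-t)  (the second summand of the
-- paper's definition is exactly the first with t replaced by -t)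
polycscGen : ℕ → ℕ → PS
polycscGen l n = (1/ ((+ 2) / 1)) ·S (polycscF l n +S negS (polycscF l n))

-- D_m^{(-l)}(n)  (argument order: l, n, m)
D : ℕ → ℕ → ℕ → ℚ
D l n m = ℕ→ℚ (m !) * polycscGen l n m

stirling1 : ℕ → ℕ → ℕ
stirling1 zero    zero    = 1
stirling1 zero    (suc j) = 0
stirling1 (suc n) zero    = 0
stirling1 (suc n) (suc j) = n ℕ.* stirling1 n (suc j) ℕ.+ stirling1 n j

symD : ℕ → ℕ → ℕ → ℚ
symD l n m = sumTo n (λ j → ℕ→ℚ (stirling1 n j) * D (l ℕ.+ j) n m)

{-# OPTIONS --safe #-}
-- Write Z = tanh(t/2) and W = e^t + 1, so that Z W = e^t − 1 and (1 − Z) W = 2.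
-- Since (q+1)^l is l! times the coefficient of t^l in e^t e^{qt} = Σ_r C(q,r) e^t (e^t − 1)^r, and
-- Σ_j [n j] x^j is the rising factorial x (x+1) ⋯ (x+n−1), the combination Σ_j [n j] Li_{-l-j}(z) is
--   l! Σ_{r ≤ l} a_r(l) (n+r)!/r! · z^{r+1} / (1 − z)^{n+r+1},   a_r(k) = [t^k] e^t (e^t − 1)^r.
-- At z = Z the two identities turn (e^t + 1)^{1-n} z^{r+1} / ((1 − z)^{n+r+1} sinh t) into
-- 2^{-(n+r)} e^t (e^t − 1)^r. At even orders M the symmetrisation in t ↦ −t is invisible, so
--   𝒟_M^{(-l)}(n) = l! M! Σ_r a_r(l) a_r(M) (n+r)! / (r! 2^{n+r}),
-- which is symmetric in l and M.
module Submission where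

open import Defs
open import Data.Nat as ℕ using (ℕ; zero; suc; _∸_; _≤_; _<_; z≤n; s≤s; _!)
import Data.Nat.Properties as ℕ
open import Data.Nat.Tactic.RingSolver using (solve-∀)
import Data.Nat.Coprimality as Coprime
import Data.Integer as ℤ
import Data.Integer.Properties as ℤ
open import Data.Rational.Properties
open import Data.Rational.Solver using (module +-*-Solver)
open import Data.Product using (_,_)
open import Level using (0ℓ)
open import Algebra.Bundles using (CommutativeSemiring)
import Algebra.Solver.Ring.NaturalCoefficients.Default
import Relation.Binary.Reasoning.Setoid
open import Relation.Nullary using (yes; no; contradiction)
open import Relation.Binary.PropositionalEquality
open ≡-Reasoning
open +-*-Solver

-- The operators of ℚ are opened only inside this module, so that _*_ is that of ℕ in theorem4p6.
module _ where
  open import Data.Rational as ℚ using (ℚ; 0ℚ; 1ℚ; _+_; _*_; -_; 1/_; mkℚ)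

  ι : ℕ → ℚ
  ι = ℕ→ℚ

  ι-suc : ∀ n → ι (suc n) ≡ 1ℚ + ι n
  ι-suc n = begin
    ι (suc n)
      ≡⟨ /-cong {p₂ = (ℤ.+ 1) ℤ.* (ℤ.+ 1) ℤ.+ (ℤ.+ n) ℤ.* (ℤ.+ 1)} {q₂ = 1 ℕ.* 1}
           (cong (λ x → (ℤ.+ 1) ℤ.+ x) (sym (ℤ.*-identityʳ (ℤ.+ n)))) refl ⟩
    ((ℤ.+ 1) ℤ.* (ℤ.+ 1) ℤ.+ (ℤ.+ n) ℤ.* (ℤ.+ 1)) ℚ./ (1 ℕ.* 1)
      ≡⟨ cong (1ℚ +_) (sym (normalize-coprime {n} {0} (Coprime.sym (Coprime.1-coprimeTo n)))) ⟩
    1ℚ + ι n ∎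

  ι-+ : ∀ m n → ι (m ℕ.+ n) ≡ ι m + ι n
  ι-+ zero    n = sym (+-identityˡ (ι n))
  ι-+ (suc m) n = begin
    ι (suc (m ℕ.+ n))  ≡⟨ ι-suc (m ℕ.+ n) ⟩
    1ℚ + ι (m ℕ.+ n)   ≡⟨ cong (1ℚ +_) (ι-+ m n) ⟩
    1ℚ + (ι m + ι n)   ≡⟨ sym (+-assoc 1ℚ (ι m) (ι n)) ⟩
    (1ℚ + ι m) + ι n   ≡⟨ cong (_+ ι n) (sym (ι-suc m)) ⟩
    ι (suc m) + ι n    ∎

  ι-* : ∀ m n → ι (m ℕ.* n) ≡ ι m * ι n
  ι-* zero    n = sym (*-zeroˡ (ι n))
  ι-* (suc m) n = begin
    ι (n ℕ.+ m ℕ.* n)   ≡⟨ ι-+ n (m ℕ.* n) ⟩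
    ι n + ι (m ℕ.* n)   ≡⟨ cong (ι n +_) (ι-* m n) ⟩
    ι n + ι m * ι n     ≡⟨ solve 2 (λ a b → a :+ b :* a := (con 1ℚ :+ b) :* a) refl (ι n) (ι m) ⟩
    (1ℚ + ι m) * ι n    ≡⟨ cong (_* ι n) (sym (ι-suc m)) ⟩
    ι (suc m) * ι n     ∎

  ι-^ : ∀ m k → ι (m ℕ.^ k) ≡ ι m ^ℚ k
  ι-^ m zero    = refl
  ι-^ m (suc k) = trans (ι-* m (m ℕ.^ k)) (cong (ι m *_) (ι-^ m k))

  1/n*ι-n≡1 : ∀ n .{{_ : ℕ.NonZero n}} → (ℤ.+ 1 ℚ./ n) * ι n ≡ 1ℚ
  1/n*ι-n≡1 (suc m) = begin
    (ℤ.+ 1 ℚ./ suc m) * ι (suc m)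
      ≡⟨ cong₂ _*_ (normalize-coprime {1} {m} 1⊥n) (normalize-coprime {suc m} {0} n⊥1) ⟩
    mkℚ (ℤ.+ 1) m 1⊥n * mkℚ (ℤ.+ suc m) 0 n⊥1
      ≡⟨ *-inverseˡ (mkℚ (ℤ.+ suc m) 0 n⊥1) ⟩
    1ℚ ∎
    where
    1⊥n : Coprime.Coprime 1 (suc m)
    1⊥n = Coprime.1-coprimeTo (suc m)
    n⊥1 : Coprime.Coprime (suc m) 1
    n⊥1 = Coprime.sym 1⊥n

  *-cancelˡ-invertible : ∀ w {x a b} → w * x ≡ 1ℚ → x * a ≡ x * b → a ≡ b
  *-cancelˡ-invertible w {x} {a} {b} wx≡1 xa≡xb = begin
    a                ≡⟨ sym (*-identityˡ a) ⟩
    1ℚ * a           ≡⟨ cong (_* a) (sym wx≡1) ⟩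
    (w * x) * a      ≡⟨ *-assoc w x a ⟩
    w * (x * a)      ≡⟨ cong (w *_) xa≡xb ⟩
    w * (x * b)      ≡⟨ sym (*-assoc w x b) ⟩
    (w * x) * b      ≡⟨ cong (_* b) wx≡1 ⟩
    1ℚ * b           ≡⟨ *-identityˡ b ⟩
    b                ∎

  -- Finite sums

  sumTo-cong : ∀ k {f g : ℕ → ℚ} → (∀ i → i ≤ k → f i ≡ g i) → sumTo k f ≡ sumTo k g
  sumTo-cong zero    f≡g = f≡g 0 z≤n
  sumTo-cong (suc k) f≡g =
    cong₂ _+_ (sumTo-cong k (λ i i≤k → f≡g i (ℕ.m≤n⇒m≤1+n i≤k))) (f≡g (suc k) ℕ.≤-refl)

  sumTo-+ : ∀ k (f g : ℕ → ℚ) → sumTo k (λ i → f i + g i) ≡ sumTo k f + sumTo k g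
  sumTo-+ zero    f g = refl
  sumTo-+ (suc k) f g = begin
    sumTo k (λ i → f i + g i) + (f (suc k) + g (suc k))
      ≡⟨ cong (_+ (f (suc k) + g (suc k))) (sumTo-+ k f g) ⟩
    (sumTo k f + sumTo k g) + (f (suc k) + g (suc k))
      ≡⟨ solve 4 (λ a b c d → (a :+ b) :+ (c :+ d) := (a :+ c) :+ (b :+ d)) refl
           (sumTo k f) (sumTo k g) (f (suc k)) (g (suc k)) ⟩
    (sumTo k f + f (suc k)) + (sumTo k g + g (suc k)) ∎

  sumTo-*ˡ : ∀ k c (f : ℕ → ℚ) → c * sumTo k f ≡ sumTo k (λ i → c * f i)
  sumTo-*ˡ zero    c f = refl
  sumTo-*ˡ (suc k) c f =
    trans (*-distribˡ-+ c (sumTo k f) (f (suc k))) (cong (_+ c * f (suc k)) (sumTo-*ˡ k c f))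

  sumTo-*ʳ : ∀ k c (f : ℕ → ℚ) → sumTo k f * c ≡ sumTo k (λ i → f i * c)
  sumTo-*ʳ k c f =
    trans (*-comm (sumTo k f) c) (trans (sumTo-*ˡ k c f) (sumTo-cong k (λ i _ → *-comm c (f i))))

  sumTo-zero : ∀ k (f : ℕ → ℚ) → (∀ i → i ≤ k → f i ≡ 0ℚ) → sumTo k f ≡ 0ℚ
  sumTo-zero k f f≡0 = trans (sumTo-cong k f≡0) (zeros k)
    where
    zeros : ∀ k → sumTo k (λ _ → 0ℚ) ≡ 0ℚ
    zeros zero    = refl
    zeros (suc k) = cong (_+ 0ℚ) (zeros k)

  sumTo-head : ∀ k (f : ℕ → ℚ) → sumTo (suc k) f ≡ f 0 + sumTo k (λ i → f (suc i))
  sumTo-head zero    f = refl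
  sumTo-head (suc k) f = trans (cong (_+ f (suc (suc k))) (sumTo-head k f)) (+-assoc (f 0) _ _)

  sumTo-+-zeros : ∀ k d (f : ℕ → ℚ) → (∀ i → k < i → f i ≡ 0ℚ) → sumTo (d ℕ.+ k) f ≡ sumTo k f
  sumTo-+-zeros k zero    f f≡0 = refl
  sumTo-+-zeros k (suc d) f f≡0 =
    trans (cong₂ _+_ (sumTo-+-zeros k d f f≡0) (f≡0 (suc (d ℕ.+ k)) (s≤s (ℕ.m≤n+m k d))))
          (+-identityʳ _)

  sumTo-extend : ∀ {k K} (f : ℕ → ℚ) → k ≤ K → (∀ i → k < i → i ≤ K → f i ≡ 0ℚ) →
                 sumTo K f ≡ sumTo k f
  sumTo-extend {k} {K} f k≤K f≡0 = begin
    sumTo K f                 ≡⟨ sym (sumTo-cong K g≡f) ⟩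
    sumTo K g                 ≡⟨ cong (λ x → sumTo x g) (sym (ℕ.m∸n+n≡m k≤K)) ⟩
    sumTo ((K ∸ k) ℕ.+ k) g   ≡⟨ sumTo-+-zeros k (K ∸ k) g g≡0 ⟩
    sumTo k g                 ≡⟨ sumTo-cong k (λ i i≤k → g≡f i (ℕ.≤-trans i≤k k≤K)) ⟩
    sumTo k f                 ∎
    where
    g : ℕ → ℚ
    g i with i ℕ.≤? K
    ... | yes _ = f i
    ... | no  _ = 0ℚ
    g≡f : ∀ i → i ≤ K → g i ≡ f i
    g≡f i i≤K with i ℕ.≤? K
    ... | yes _   = refl
    ... | no  i≰K = contradiction i≤K i≰K
    g≡0 : ∀ i → k < i → g i ≡ 0ℚ
    g≡0 i k<i with i ℕ.≤? K
    ... | yes i≤K = f≡0 i k<i i≤K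
    ... | no  _   = refl

  sumTo-reverse : ∀ k (f : ℕ → ℚ) → sumTo k f ≡ sumTo k (λ i → f (k ∸ i))
  sumTo-reverse zero    f = refl
  sumTo-reverse (suc k) f = begin
    sumTo k f + f (suc k)                    ≡⟨ cong (_+ f (suc k)) (sumTo-reverse k f) ⟩
    sumTo k (λ i → f (k ∸ i)) + f (suc k)    ≡⟨ +-comm (sumTo k (λ i → f (k ∸ i))) (f (suc k)) ⟩
    f (suc k) + sumTo k (λ i → f (k ∸ i))    ≡⟨ sym (sumTo-head k (λ i → f (suc k ∸ i))) ⟩
    sumTo (suc k) (λ i → f (suc k ∸ i))      ∎

  sumTo-swap : ∀ k K (F : ℕ → ℕ → ℚ) →
               sumTo k (λ i → sumTo K (F i)) ≡ sumTo K (λ j → sumTo k (λ i → F i j))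
  sumTo-swap zero    K F = refl
  sumTo-swap (suc k) K F =
    trans (cong (_+ sumTo K (F (suc k))) (sumTo-swap k K F))
          (sym (sumTo-+ K (λ j → sumTo k (λ i → F i j)) (F (suc k))))

  sumTo-triangle : ∀ k (G : ℕ → ℕ → ℚ) →
                   sumTo k (λ i → sumTo i (λ a → G a i))
                   ≡ sumTo k (λ a → sumTo (k ∸ a) (λ b → G a (a ℕ.+ b)))
  sumTo-triangle zero    G = refl
  sumTo-triangle (suc k) G = begin
    sumTo k (λ i → sumTo i (λ a → G a i)) + sumTo (suc k) (λ a → G a (suc k))
      ≡⟨ cong (_+ sumTo (suc k) (λ a → G a (suc k))) (sumTo-triangle k G) ⟩
    R k + (sumTo k (λ a → G a (suc k)) + G (suc k) (suc k))
      ≡⟨ sym (+-assoc (R k) (sumTo k (λ a → G a (suc k))) (G (suc k) (suc k))) ⟩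
    (R k + sumTo k (λ a → G a (suc k))) + G (suc k) (suc k)
      ≡⟨ cong₂ _+_ (trans (sym (sumTo-+ k _ (λ a → G a (suc k)))) (sumTo-cong k row))
                   (trans (cong (G (suc k)) (sym (ℕ.+-identityʳ (suc k))))
                          (cong (λ x → sumTo x (λ b → G (suc k) (suc k ℕ.+ b))) (sym (ℕ.n∸n≡0 k)))) ⟩
    R (suc k) ∎
    where
    R : ℕ → ℚ
    R k' = sumTo k' (λ a → sumTo (k' ∸ a) (λ b → G a (a ℕ.+ b)))
    row : ∀ a → a ≤ k → sumTo (k ∸ a) (λ b → G a (a ℕ.+ b)) + G a (suc k)
                        ≡ sumTo (suc k ∸ a) (λ b → G a (a ℕ.+ b))
    row a a≤k = begin
      sumTo (k ∸ a) (λ b → G a (a ℕ.+ b)) + G a (suc k)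
        ≡⟨ cong (λ x → sumTo (k ∸ a) (λ b → G a (a ℕ.+ b)) + G a x)
             (trans (cong suc (sym (ℕ.m+[n∸m]≡n a≤k))) (sym (ℕ.+-suc a (k ∸ a)))) ⟩
      sumTo (suc (k ∸ a)) (λ b → G a (a ℕ.+ b))
        ≡⟨ cong (λ x → sumTo x (λ b → G a (a ℕ.+ b))) (sym (ℕ.+-∸-assoc 1 a≤k)) ⟩
      sumTo (suc k ∸ a) (λ b → G a (a ℕ.+ b)) ∎

  -- Formal power series

  infix 4 _≈_
  _≈_ : PS → PS → Set
  f ≈ g = ∀ k → f k ≡ g k

  ≈-refl : ∀ {f} → f ≈ f
  ≈-refl k = refl

  ≈-sym : ∀ {f g} → f ≈ g → g ≈ f
  ≈-sym f≈g k = sym (f≈g k)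

  ≈-trans : ∀ {f g h} → f ≈ g → g ≈ h → f ≈ h
  ≈-trans f≈g g≈h k = trans (f≈g k) (g≈h k)

  zeroS : PS
  zeroS _ = 0ℚ

  +S-cong : ∀ {f f' g g'} → f ≈ f' → g ≈ g' → f +S g ≈ f' +S g'
  +S-cong f≈f' g≈g' k = cong₂ _+_ (f≈f' k) (g≈g' k)

  +S-congˡ : ∀ f {g g'} → g ≈ g' → f +S g ≈ f +S g'
  +S-congˡ f {g} {g'} = +S-cong {f} {f} {g} {g'} ≈-refl

  +S-identityʳ : ∀ f → f +S zeroS ≈ f
  +S-identityʳ f k = +-identityʳ (f k)

  *S-cong : ∀ {f f' g g'} → f ≈ f' → g ≈ g' → f *S g ≈ f' *S g'
  *S-cong f≈f' g≈g' k = sumTo-cong k (λ i _ → cong₂ _*_ (f≈f' i) (g≈g' (k ∸ i)))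

  *S-congˡ : ∀ f {g g'} → g ≈ g' → f *S g ≈ f *S g'
  *S-congˡ f {g} {g'} = *S-cong {f} {f} {g} {g'} ≈-refl

  *S-congʳ : ∀ f {g g'} → g ≈ g' → g *S f ≈ g' *S f
  *S-congʳ f {g} {g'} g≈g' = *S-cong {g} {g'} {f} {f} g≈g' ≈-refl

  ·S-cong : ∀ c {f f'} → f ≈ f' → c ·S f ≈ c ·S f'
  ·S-cong c f≈f' k = cong (c *_) (f≈f' k)

  *S-comm : ∀ f g → f *S g ≈ g *S f
  *S-comm f g k = begin
    sumTo k (λ i → f i * g (k ∸ i))
      ≡⟨ sumTo-reverse k _ ⟩
    sumTo k (λ i → f (k ∸ i) * g (k ∸ (k ∸ i)))
      ≡⟨ sumTo-cong k (λ i i≤k → trans (cong (λ x → f (k ∸ i) * g x) (ℕ.m∸[m∸n]≡n i≤k))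
                                        (*-comm (f (k ∸ i)) (g i))) ⟩
    sumTo k (λ i → g i * f (k ∸ i)) ∎

  *S-assoc : ∀ f g h → (f *S g) *S h ≈ f *S (g *S h)
  *S-assoc f g h k = begin
    sumTo k (λ i → sumTo i (λ a → f a * g (i ∸ a)) * h (k ∸ i))
      ≡⟨ sumTo-cong k (λ i _ → sumTo-*ʳ i (h (k ∸ i)) (λ a → f a * g (i ∸ a))) ⟩
    sumTo k (λ i → sumTo i (λ a → f a * g (i ∸ a) * h (k ∸ i)))
      ≡⟨ sumTo-triangle k (λ a i → f a * g (i ∸ a) * h (k ∸ i)) ⟩
    sumTo k (λ a → sumTo (k ∸ a) (λ b → f a * g ((a ℕ.+ b) ∸ a) * h (k ∸ (a ℕ.+ b))))
      ≡⟨ sumTo-cong k (λ a _ → trans (sumTo-cong (k ∸ a) (λ b _ → inner a b))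
                                    (sym (sumTo-*ˡ (k ∸ a) (f a) (λ b → g b * h (k ∸ a ∸ b))))) ⟩
    sumTo k (λ a → f a * sumTo (k ∸ a) (λ b → g b * h (k ∸ a ∸ b))) ∎
    where
    inner : ∀ a b → f a * g ((a ℕ.+ b) ∸ a) * h (k ∸ (a ℕ.+ b)) ≡ f a * (g b * h (k ∸ a ∸ b))
    inner a b = trans (cong₂ (λ x y → f a * g x * h y) (ℕ.m+n∸m≡n a b) (sym (ℕ.∸-+-assoc k a b)))
                      (*-assoc (f a) (g b) (h (k ∸ a ∸ b)))

  *S-distribˡ : ∀ f g h → f *S (g +S h) ≈ (f *S g) +S (f *S h)
  *S-distribˡ f g h k =
    trans (sumTo-cong k (λ i _ → *-distribˡ-+ (f i) (g (k ∸ i)) (h (k ∸ i)))) (sumTo-+ k _ _)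

  *S-distribʳ : ∀ f g h → (g +S h) *S f ≈ (g *S f) +S (h *S f)
  *S-distribʳ f g h k =
    trans (sumTo-cong k (λ i _ → *-distribʳ-+ (f (k ∸ i)) (g i) (h i))) (sumTo-+ k _ _)

  *S-identityˡ : ∀ f → oneS *S f ≈ f
  *S-identityˡ f zero    = *-identityˡ (f 0)
  *S-identityˡ f (suc k) = begin
    sumTo (suc k) (λ i → oneS i * f (suc k ∸ i))
      ≡⟨ sumTo-head k _ ⟩
    1ℚ * f (suc k) + sumTo k (λ i → 0ℚ * f (k ∸ i))
      ≡⟨ cong₂ _+_ (*-identityˡ (f (suc k))) (sumTo-zero k _ (λ i _ → *-zeroˡ (f (k ∸ i)))) ⟩
    f (suc k) + 0ℚ
      ≡⟨ +-identityʳ (f (suc k)) ⟩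
    f (suc k) ∎

  *S-identityʳ : ∀ f → f *S oneS ≈ f
  *S-identityʳ f = ≈-trans (*S-comm f oneS) (*S-identityˡ f)

  *S-zeroˡ : ∀ f → zeroS *S f ≈ zeroS
  *S-zeroˡ f k = sumTo-zero k _ (λ i _ → *-zeroˡ (f (k ∸ i)))

  *S-zeroʳ : ∀ f → f *S zeroS ≈ zeroS
  *S-zeroʳ f = ≈-trans (*S-comm f zeroS) (*S-zeroˡ f)

  PS-commutativeSemiring : CommutativeSemiring 0ℓ 0ℓ
  PS-commutativeSemiring = record
    { Carrier = PS ; _≈_ = _≈_ ; _+_ = _+S_ ; _*_ = _*S_ ; 0# = zeroS ; 1# = oneS
    ; isCommutativeSemiring = record
      { isSemiring = record
        { isSemiringWithoutAnnihilatingZero = record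
          { +-isCommutativeMonoid = record
            { isMonoid = record
              { isSemigroup = record
                { isMagma = record
                  { isEquivalence = record { refl = λ {f} → ≈-refl {f}
                                           ; sym = λ {f} {g} → ≈-sym {f} {g}
                                           ; trans = λ {f} {g} {h} → ≈-trans {f} {g} {h} }
                  ; ∙-cong = λ {f} {f'} {g} {g'} → +S-cong {f} {f'} {g} {g'} }
                ; assoc = λ f g h k → +-assoc (f k) (g k) (h k) }
              ; identity = (λ f k → +-identityˡ (f k)) , (λ f k → +-identityʳ (f k)) }
            ; comm = λ f g k → +-comm (f k) (g k) }
          ; *-cong = λ {f} {f'} {g} {g'} → *S-cong {f} {f'} {g} {g'}
          ; *-assoc = *S-assoc
          ; *-identity = *S-identityˡ , *S-identityʳ
          ; distrib = *S-distribˡ , *S-distribʳ }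
        ; zero = *S-zeroˡ , *S-zeroʳ }
      ; *-comm = *S-comm } }

  module S = Algebra.Solver.Ring.NaturalCoefficients.Default PS-commutativeSemiring
  open Relation.Binary.Reasoning.Setoid (CommutativeSemiring.setoid PS-commutativeSemiring)
    using (step-≈-⟩) renaming (begin_ to begin≈_; _∎ to _∎≈)

  ·S-*S : ∀ c f g → (c ·S f) *S g ≈ c ·S (f *S g)
  ·S-*S c f g k = trans (sumTo-cong k (λ i _ → *-assoc c (f i) (g (k ∸ i)))) (sym (sumTo-*ˡ k c _))

  *S-·S : ∀ c f g → f *S (c ·S g) ≈ c ·S (f *S g)
  *S-·S c f g = ≈-trans (*S-comm f (c ·S g)) (≈-trans (·S-*S c g f) (·S-cong c (*S-comm g f)))

  ·S-·S : ∀ c d f → c ·S (d ·S f) ≈ (c * d) ·S f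
  ·S-·S c d f k = sym (*-assoc c d (f k))

  ·S-identity : ∀ f → 1ℚ ·S f ≈ f
  ·S-identity f k = *-identityˡ (f k)

  constS : ℚ → PS
  constS c = c ·S oneS

  ·S≈constS-*S : ∀ c f → c ·S f ≈ constS c *S f
  ·S≈constS-*S c f = ≈-sym (≈-trans (·S-*S c oneS f) (·S-cong c (*S-identityˡ f)))

  constS-* : ∀ c d → constS c *S constS d ≈ constS (c * d)
  constS-* c d = ≈-trans (≈-sym (·S≈constS-*S c (constS d))) (·S-·S c d oneS)

  powS-cong : ∀ {f g} j → f ≈ g → powS f j ≈ powS g j
  powS-cong zero    f≈g = ≈-refl
  powS-cong (suc j) f≈g = *S-cong f≈g (powS-cong j f≈g)

  powS-+ : ∀ f i j → powS f (i ℕ.+ j) ≈ powS f i *S powS f j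
  powS-+ f zero    j = ≈-sym (*S-identityˡ (powS f j))
  powS-+ f (suc i) j =
    ≈-trans (*S-congˡ f (powS-+ f i j)) (≈-sym (*S-assoc f (powS f i) (powS f j)))

  powS-* : ∀ f g j → powS (f *S g) j ≈ powS f j *S powS g j
  powS-* f g zero    = ≈-sym (*S-identityˡ oneS)
  powS-* f g (suc j) = begin≈
    (f *S g) *S powS (f *S g) j          ≈⟨ *S-congˡ (f *S g) (powS-* f g j) ⟩
    (f *S g) *S (powS f j *S powS g j)
      ≈⟨ S.solve 4 (λ f g a b → (f S.:* g) S.:* (a S.:* b) S.:= (f S.:* a) S.:* (g S.:* b))
           ≈-refl f g (powS f j) (powS g j) ⟩
    (f *S powS f j) *S (g *S powS g j)   ∎≈

  powS-oneS : ∀ k → powS oneS k ≈ oneS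
  powS-oneS zero    = ≈-refl
  powS-oneS (suc k) = ≈-trans (*S-identityˡ (powS oneS k)) (powS-oneS k)

  powS-inverse : ∀ {f g} → f *S g ≈ oneS → ∀ j → powS f j *S powS g j ≈ oneS
  powS-inverse {f} {g} fg≈1 j =
    ≈-trans (≈-sym (powS-* f g j)) (≈-trans (powS-cong j fg≈1) (powS-oneS j))

  powS-constS : ∀ c j → powS (constS c) j ≈ constS (c ^ℚ j)
  powS-constS c zero    k = sym (*-identityˡ (oneS k))
  powS-constS c (suc j) = ≈-trans (*S-congˡ (constS c) (powS-constS c j)) (constS-* c (c ^ℚ j))

  divT-cong : ∀ {f g} → f ≈ g → divT f ≈ divT g
  divT-cong f≈g k = f≈g (suc k)

  divT-*ˡ : ∀ f g → f 0 ≡ 0ℚ → divT (f *S g) ≈ divT f *S g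
  divT-*ˡ f g f0≡0 k = begin
    sumTo (suc k) (λ i → f i * g (suc k ∸ i))
      ≡⟨ sumTo-head k _ ⟩
    f 0 * g (suc k) + (divT f *S g) k
      ≡⟨ cong (λ x → x * g (suc k) + (divT f *S g) k) f0≡0 ⟩
    0ℚ * g (suc k) + (divT f *S g) k
      ≡⟨ cong (_+ (divT f *S g) k) (*-zeroˡ (g (suc k))) ⟩
    0ℚ + (divT f *S g) k
      ≡⟨ +-identityˡ _ ⟩
    (divT f *S g) k ∎

  divT-*ʳ : ∀ f g → g 0 ≡ 0ℚ → divT (f *S g) ≈ f *S divT g
  divT-*ʳ f g g0≡0 =
    ≈-trans (divT-cong (*S-comm f g)) (≈-trans (divT-*ˡ g f g0≡0) (*S-comm (divT g) f))

  -- Composition and inverses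

  infix 4 _hasOrder≥_
  _hasOrder≥_ : PS → ℕ → Set
  f hasOrder≥ p = ∀ k → k < p → f k ≡ 0ℚ

  k<p+q⇒k∸i<q : ∀ {p i k q} → p ≤ i → i ≤ k → k < p ℕ.+ q → k ∸ i < q
  k<p+q⇒k∸i<q {zero}  {i}     {k}     _       _       k<q       = ℕ.≤-<-trans (ℕ.m∸n≤m k i) k<q
  k<p+q⇒k∸i<q {suc p} {suc i} {suc k} (s≤s p≤i) (s≤s i≤k) (s≤s k<p+q) = k<p+q⇒k∸i<q p≤i i≤k k<p+q

  k∸i<j⇒k<i+j : ∀ {i j k} → i ≤ k → k ∸ i < j → k < i ℕ.+ j
  k∸i<j⇒k<i+j {i} {j} i≤k k∸i<j = subst (_< i ℕ.+ j) (ℕ.m+[n∸m]≡n i≤k) (ℕ.+-monoʳ-< i k∸i<j)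

  *S-hasOrder≥ : ∀ {f g p q} → f hasOrder≥ p → g hasOrder≥ q → f *S g hasOrder≥ p ℕ.+ q
  *S-hasOrder≥ {f} {g} {p} {q} f≥p g≥q k k<p+q = sumTo-zero k _ term
    where
    term : ∀ i → i ≤ k → f i * g (k ∸ i) ≡ 0ℚ
    term i i≤k with i ℕ.<? p
    ... | yes i<p = trans (cong (_* g (k ∸ i)) (f≥p i i<p)) (*-zeroˡ (g (k ∸ i)))
    ... | no  i≮p = trans (cong (f i *_) (g≥q (k ∸ i) (k<p+q⇒k∸i<q (ℕ.≮⇒≥ i≮p) i≤k k<p+q)))
                          (*-zeroʳ (f i))

  powS-hasOrder≥ : ∀ {u} → u 0 ≡ 0ℚ → ∀ j → powS u j hasOrder≥ j
  powS-hasOrder≥ u0≡0 zero    k ()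
  powS-hasOrder≥ {u} u0≡0 (suc j) = *S-hasOrder≥ {u} {powS u j} {1} {j} u≥1 (powS-hasOrder≥ u0≡0 j)
    where
    u≥1 : u hasOrder≥ 1
    u≥1 zero    _ = u0≡0
    u≥1 (suc k) (s≤s ())

  compose-extend : ∀ a {u} → u 0 ≡ 0ℚ → ∀ {k K} → k ≤ K →
                   compose a u k ≡ sumTo K (λ j → a j * powS u j k)
  compose-extend a {u} u0≡0 {k} k≤K =
    sym (sumTo-extend _ k≤K (λ j k<j _ → trans (cong (a j *_) (powS-hasOrder≥ u0≡0 j k k<j))
                                              (*-zeroʳ (a j))))

  compose-congˡ : ∀ {a b} u → a ≈ b → compose a u ≈ compose b u
  compose-congˡ u a≈b k = sumTo-cong k (λ j _ → cong (_* powS u j k) (a≈b j))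

  compose-congʳ : ∀ a {u v} → u ≈ v → compose a u ≈ compose a v
  compose-congʳ a u≈v k = sumTo-cong k (λ j _ → cong (a j *_) (powS-cong j u≈v k))

  compose-+S : ∀ a b u → compose (a +S b) u ≈ compose a u +S compose b u
  compose-+S a b u k =
    trans (sumTo-cong k (λ j _ → *-distribʳ-+ (powS u j k) (a j) (b j))) (sumTo-+ k _ _)

  compose-·S : ∀ c a u → compose (c ·S a) u ≈ c ·S compose a u
  compose-·S c a u k =
    trans (sumTo-cong k (λ j _ → *-assoc c (a j) (powS u j k))) (sym (sumTo-*ˡ k c _))

  sumS : ℕ → (ℕ → PS) → PS
  sumS L g k = sumTo L (λ r → g r k)

  sumS-cong : ∀ L {g g' : ℕ → PS} → (∀ r → g r ≈ g' r) → sumS L g ≈ sumS L g'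
  sumS-cong L g≈g' k = sumTo-cong L (λ r _ → g≈g' r k)

  sumS-*S : ∀ L (g : ℕ → PS) f → sumS L g *S f ≈ sumS L (λ r → g r *S f)
  sumS-*S L g f k =
    trans (sumTo-cong k (λ i _ → sumTo-*ʳ L (f (k ∸ i)) (λ r → g r i))) (sumTo-swap k L _)

  *S-sumS : ∀ L f (g : ℕ → PS) → f *S sumS L g ≈ sumS L (λ r → f *S g r)
  *S-sumS L f g = ≈-trans (*S-comm f (sumS L g))
                  (≈-trans (sumS-*S L g f) (sumS-cong L (λ r → *S-comm (g r) f)))

  compose-sumS : ∀ L (g : ℕ → PS) u → compose (sumS L g) u ≈ sumS L (λ r → compose (g r) u)
  compose-sumS L g u k =
    trans (sumTo-cong k (λ j _ → sumTo-*ʳ L (powS u j k) (λ r → g r j))) (sumTo-swap k L _)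

  compose-oneS : ∀ u → compose oneS u ≈ oneS
  compose-oneS u zero    = *-identityˡ 1ℚ
  compose-oneS u (suc k) = begin
    sumTo (suc k) (λ j → oneS j * powS u j (suc k))
      ≡⟨ sumTo-head k _ ⟩
    1ℚ * 0ℚ + sumTo k (λ j → 0ℚ * powS u (suc j) (suc k))
      ≡⟨ cong₂ _+_ (*-zeroʳ 1ℚ) (sumTo-zero k _ (λ j _ → *-zeroˡ (powS u (suc j) (suc k)))) ⟩
    0ℚ + 0ℚ
      ≡⟨ +-identityˡ 0ℚ ⟩
    0ℚ ∎

  X : PS
  X zero          = 0ℚ
  X (suc zero)    = 1ℚ
  X (suc (suc _)) = 0ℚ

  compose-X : ∀ u → u 0 ≡ 0ℚ → compose X u ≈ u
  compose-X u u0≡0 zero    = trans (*-zeroˡ 1ℚ) (sym u0≡0)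
  compose-X u u0≡0 (suc k) = begin
    compose X u (suc k)
      ≡⟨ sumTo-head k _ ⟩
    0ℚ * oneS (suc k) + sumTo k (λ j → X (suc j) * powS u (suc j) (suc k))
      ≡⟨ cong₂ _+_ (*-zeroˡ (oneS (suc k))) (sumTo-extend _ z≤n higher) ⟩
    0ℚ + 1ℚ * powS u 1 (suc k)
      ≡⟨ trans (+-identityˡ _) (*-identityˡ _) ⟩
    powS u 1 (suc k)
      ≡⟨ *S-identityʳ u (suc k) ⟩
    u (suc k) ∎
    where
    higher : ∀ j → 0 < j → j ≤ k → X (suc j) * powS u (suc j) (suc k) ≡ 0ℚ
    higher (suc j) _ _ = *-zeroˡ (powS u (suc (suc j)) (suc k))

  sumTo-*-sumTo : ∀ k K (f g : ℕ → ℚ) →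
                  sumTo k f * sumTo K g ≡ sumTo k (λ i → sumTo K (λ j → f i * g j))
  sumTo-*-sumTo k K f g = trans (sumTo-*ʳ k _ f) (sumTo-cong k (λ i _ → sumTo-*ˡ K (f i) g))

  compose-*S-square : ∀ a b u → u 0 ≡ 0ℚ → ∀ k →
                      compose (a *S b) u k ≡ sumTo k (λ i → sumTo k (λ j → a i * b j * powS u (i ℕ.+ j) k))
  compose-*S-square a b u u0≡0 k = begin
    sumTo k (λ s → sumTo s (λ i → a i * b (s ∸ i)) * P s k)
      ≡⟨ sumTo-cong k (λ s _ → sumTo-*ʳ s (P s k) _) ⟩
    sumTo k (λ s → sumTo s (λ i → a i * b (s ∸ i) * P s k))
      ≡⟨ sumTo-triangle k (λ i s → a i * b (s ∸ i) * P s k) ⟩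
    sumTo k (λ i → sumTo (k ∸ i) (λ j → a i * b ((i ℕ.+ j) ∸ i) * P (i ℕ.+ j) k))
      ≡⟨ sumTo-cong k (λ i i≤k → trans (sumTo-cong (k ∸ i) (λ j _ → cong (λ x → a i * b x * P (i ℕ.+ j) k)
                                                                           (ℕ.m+n∸m≡n i j)))
                                       (sym (sumTo-extend _ (ℕ.m∸n≤m k i) (λ j k∸i<j _ → high i j i≤k k∸i<j)))) ⟩
    sumTo k (λ i → sumTo k (λ j → a i * b j * P (i ℕ.+ j) k)) ∎
    where
    P : ℕ → PS
    P = powS u
    high : ∀ i j → i ≤ k → k ∸ i < j → a i * b j * P (i ℕ.+ j) k ≡ 0ℚ
    high i j i≤k k∸i<j = trans (cong (a i * b j *_) (powS-hasOrder≥ u0≡0 (i ℕ.+ j) k (k∸i<j⇒k<i+j i≤k k∸i<j)))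
                               (*-zeroʳ (a i * b j))

  compose-*S : ∀ a b u → u 0 ≡ 0ℚ → compose (a *S b) u ≈ compose a u *S compose b u
  compose-*S a b u u0≡0 k = begin
    compose (a *S b) u k
      ≡⟨ compose-*S-square a b u u0≡0 k ⟩
    sumTo k (λ i → sumTo k (λ j → a i * b j * P (i ℕ.+ j) k))
      ≡⟨ sumTo-cong k (λ i _ → sumTo-cong k (λ j _ → split i j)) ⟩
    sumTo k (λ i → sumTo k (λ j → sumTo k (λ p → (a i * P i p) * (b j * P j (k ∸ p)))))
      ≡⟨ trans (sumTo-cong k (λ i _ → sumTo-swap k k _)) (sumTo-swap k k _) ⟩
    sumTo k (λ p → sumTo k (λ i → sumTo k (λ j → (a i * P i p) * (b j * P j (k ∸ p)))))
      ≡⟨ sym (sumTo-cong k (λ p _ → sumTo-*-sumTo k k _ _)) ⟩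
    sumTo k (λ p → sumTo k (λ i → a i * P i p) * sumTo k (λ j → b j * P j (k ∸ p)))
      ≡⟨ sym (sumTo-cong k (λ p p≤k → cong₂ _*_ (compose-extend a u0≡0 p≤k)
                                                 (compose-extend b u0≡0 (ℕ.m∸n≤m k p)))) ⟩
    (compose a u *S compose b u) k ∎
    where
    P : ℕ → PS
    P = powS u
    split : ∀ i j → a i * b j * P (i ℕ.+ j) k ≡ sumTo k (λ p → (a i * P i p) * (b j * P j (k ∸ p)))
    split i j = begin
      a i * b j * P (i ℕ.+ j) k
        ≡⟨ cong (a i * b j *_) (powS-+ u i j k) ⟩
      a i * b j * sumTo k (λ p → P i p * P j (k ∸ p))
        ≡⟨ sumTo-*ˡ k (a i * b j) _ ⟩
      sumTo k (λ p → a i * b j * (P i p * P j (k ∸ p)))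
        ≡⟨ sumTo-cong k (λ p _ → solve 4 (λ w x y v → w :* y :* (x :* v) := (w :* x) :* (y :* v)) refl
                                          (a i) (P i p) (b j) (P j (k ∸ p))) ⟩
      sumTo k (λ p → (a i * P i p) * (b j * P j (k ∸ p))) ∎

  compose-powS : ∀ a u → u 0 ≡ 0ℚ → ∀ j → compose (powS a j) u ≈ powS (compose a u) j
  compose-powS a u u0≡0 zero    = compose-oneS u
  compose-powS a u u0≡0 (suc j) =
    ≈-trans (compose-*S a (powS a j) u u0≡0) (*S-congˡ (compose a u) (compose-powS a u u0≡0 j))

  geometricS : PS
  geometricS _ = 1ℚ

  1-X : PS
  1-X = oneS +S ((- 1ℚ) ·S X)

  1-X*geometricS≈1 : 1-X *S geometricS ≈ oneS
  1-X*geometricS≈1 zero    = refl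
  1-X*geometricS≈1 (suc k) = begin
    sumTo (suc k) (λ i → 1-X i * 1ℚ)                 ≡⟨ sumTo-head k _ ⟩
    1-X 0 * 1ℚ + sumTo k (λ i → 1-X (suc i) * 1ℚ)    ≡⟨ cong (1-X 0 * 1ℚ +_) (sumTo-extend _ z≤n higher) ⟩
    1-X 0 * 1ℚ + 1-X 1 * 1ℚ                          ≡⟨⟩
    0ℚ                                              ∎
    where
    higher : ∀ j → 0 < j → j ≤ k → 1-X (suc j) * 1ℚ ≡ 0ℚ
    higher (suc j) _ _ = refl

  compose-1-X : ∀ u → u 0 ≡ 0ℚ → compose 1-X u ≈ oneS +S ((- 1ℚ) ·S u)
  compose-1-X u u0≡0 =
    ≈-trans (compose-+S oneS ((- 1ℚ) ·S X) u)
            (+S-cong {compose oneS u} {oneS} (compose-oneS u)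
                     (≈-trans (compose-·S (- 1ℚ) X u) (·S-cong (- 1ℚ) (compose-X u u0≡0))))

  module _ (f : PS) .{{_ : ℚ.NonZero (f 0)}} where
    private
      h : PS
      h zero    = 0ℚ
      h (suc k) = - (f (suc k) * 1/ f 0)

      f≈ : f ≈ f 0 ·S compose 1-X h
      f≈ k = begin
        f k                                ≡⟨ coefficient k ⟩
        f 0 * (oneS k + (- 1ℚ) * h k)      ≡⟨ cong (f 0 *_) (sym (compose-1-X h refl k)) ⟩
        f 0 * compose 1-X h k              ∎
        where
        coefficient : ∀ k → f k ≡ f 0 * (oneS k + (- 1ℚ) * h k)
        coefficient zero    = sym (trans (cong (f 0 *_) (+-identityʳ 1ℚ)) (*-identityʳ (f 0)))
        coefficient (suc k) = sym (begin
          f 0 * (0ℚ + (- 1ℚ) * (- (f (suc k) * 1/ f 0)))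
            ≡⟨ solve 3 (λ a b c → a :* (con 0ℚ :+ (:- con 1ℚ) :* (:- (b :* c))) := b :* (a :* c)) refl
                     (f 0) (f (suc k)) (1/ f 0) ⟩
          f (suc k) * (f 0 * 1/ f 0)    ≡⟨ cong (f (suc k) *_) (*-inverseʳ (f 0)) ⟩
          f (suc k) * 1ℚ                ≡⟨ *-identityʳ (f (suc k)) ⟩
          f (suc k)                     ∎)

      -- invS is defined through a where-bound copy of h, which is equal to h only pointwise.
      invS≈ : invS f ≈ (1/ f 0) ·S compose geometricS h
      invS≈ = ·S-cong (1/ f 0) (compose-congʳ geometricS h≈)
        where
        h≈ : ∀ k → _ ≡ h k
        h≈ zero    = refl
        h≈ (suc k) = refl

    *S-inverseʳ : f *S invS f ≈ oneS
    *S-inverseʳ = begin≈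
      f *S invS f
        ≈⟨ *S-cong {f} {f 0 ·S compose 1-X h} f≈ invS≈ ⟩
      (f 0 ·S compose 1-X h) *S ((1/ f 0) ·S compose geometricS h)
        ≈⟨ ≈-trans (·S-*S (f 0) (compose 1-X h) ((1/ f 0) ·S compose geometricS h))
                   (·S-cong (f 0) (*S-·S (1/ f 0) (compose 1-X h) (compose geometricS h))) ⟩
      f 0 ·S ((1/ f 0) ·S (compose 1-X h *S compose geometricS h))
        ≈⟨ ·S-·S (f 0) (1/ f 0) (compose 1-X h *S compose geometricS h) ⟩
      (f 0 * 1/ f 0) ·S (compose 1-X h *S compose geometricS h)
        ≈⟨ (λ k → cong (_* (compose 1-X h *S compose geometricS h) k) (*-inverseʳ (f 0))) ⟩
      1ℚ ·S (compose 1-X h *S compose geometricS h)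
        ≈⟨ ≈-trans (·S-identity (compose 1-X h *S compose geometricS h)) (≈-sym (compose-*S 1-X geometricS h refl)) ⟩
      compose (1-X *S geometricS) h
        ≈⟨ ≈-trans (compose-congˡ h 1-X*geometricS≈1) (compose-oneS h) ⟩
      oneS ∎≈


  -- Exponentials

  ^ℚ-* : ∀ a b k → (a * b) ^ℚ k ≡ a ^ℚ k * b ^ℚ k
  ^ℚ-* a b zero    = refl
  ^ℚ-* a b (suc k) =
    trans (cong ((a * b) *_) (^ℚ-* a b k))
          (solve 4 (λ a b x y → (a :* b) :* (x :* y) := (a :* x) :* (b :* y)) refl a b (a ^ℚ k) (b ^ℚ k))

  ^ℚ-+ : ∀ a i j → a ^ℚ (i ℕ.+ j) ≡ a ^ℚ i * a ^ℚ j
  ^ℚ-+ a zero    j = sym (*-identityˡ _)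
  ^ℚ-+ a (suc i) j = trans (cong (a *_) (^ℚ-+ a i j)) (sym (*-assoc a _ _))

  1^ℚ : ∀ k → 1ℚ ^ℚ k ≡ 1ℚ
  1^ℚ zero    = refl
  1^ℚ (suc k) = trans (*-identityˡ _) (1^ℚ k)

  expS*ι!≡1 : ∀ k → expS k * ι (k !) ≡ 1ℚ
  expS*ι!≡1 k = 1/n*ι-n≡1 (k !) {{k ℕ.!≢0}}

  expS-suc : ∀ k → ι (suc k) * expS (suc k) ≡ expS k
  expS-suc k = *-cancelˡ-invertible (expS k) (expS*ι!≡1 k) (begin
    ι (k !) * (ι (suc k) * expS (suc k))
      ≡⟨ solve 3 (λ a b c → a :* (b :* c) := c :* (b :* a)) refl (ι (k !)) (ι (suc k)) (expS (suc k)) ⟩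
    expS (suc k) * (ι (suc k) * ι (k !))
      ≡⟨ cong (expS (suc k) *_) (sym (ι-* (suc k) (k !))) ⟩
    expS (suc k) * ι (suc k !)
      ≡⟨ trans (expS*ι!≡1 (suc k)) (sym (expS*ι!≡1 k)) ⟩
    expS k * ι (k !)
      ≡⟨ *-comm (expS k) (ι (k !)) ⟩
    ι (k !) * expS k ∎)

  ∂ : PS → PS
  ∂ f k = ι (suc k) * f (suc k)

  ∂-*S : ∀ f g → ∂ (f *S g) ≈ (∂ f *S g) +S (f *S ∂ g)
  ∂-*S f g k = begin
    ι (suc k) * sumTo (suc k) (λ i → f i * g (suc k ∸ i))
      ≡⟨ sumTo-*ˡ (suc k) (ι (suc k)) _ ⟩
    sumTo (suc k) (λ i → ι (suc k) * (f i * g (suc k ∸ i)))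
      ≡⟨ sumTo-cong (suc k) (λ i i≤k → split i i≤k) ⟩
    sumTo (suc k) (λ i → ι i * (f i * g (suc k ∸ i)) + ι (suc k ∸ i) * (f i * g (suc k ∸ i)))
      ≡⟨ sumTo-+ (suc k) _ _ ⟩
    sumTo (suc k) (λ i → ι i * (f i * g (suc k ∸ i))) + sumTo (suc k) (λ i → ι (suc k ∸ i) * (f i * g (suc k ∸ i)))
      ≡⟨ cong₂ _+_ left right ⟩
    (∂ f *S g) k + (f *S ∂ g) k ∎
    where
    split : ∀ i → i ≤ suc k →
            ι (suc k) * (f i * g (suc k ∸ i)) ≡ ι i * (f i * g (suc k ∸ i)) + ι (suc k ∸ i) * (f i * g (suc k ∸ i))
    split i i≤k = trans (cong (λ x → ι x * (f i * g (suc k ∸ i))) (sym (ℕ.m+[n∸m]≡n i≤k)))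
                        (trans (cong (_* (f i * g (suc k ∸ i))) (ι-+ i (suc k ∸ i))) (*-distribʳ-+ _ (ι i) _))
    left : sumTo (suc k) (λ i → ι i * (f i * g (suc k ∸ i))) ≡ (∂ f *S g) k
    left = begin
      sumTo (suc k) (λ i → ι i * (f i * g (suc k ∸ i)))
        ≡⟨ sumTo-head k _ ⟩
      0ℚ * (f 0 * g (suc k)) + sumTo k (λ i → ι (suc i) * (f (suc i) * g (k ∸ i)))
        ≡⟨ trans (cong (_+ sumTo k (λ i → ι (suc i) * (f (suc i) * g (k ∸ i)))) (*-zeroˡ (f 0 * g (suc k))))
                 (+-identityˡ _) ⟩
      sumTo k (λ i → ι (suc i) * (f (suc i) * g (k ∸ i)))
        ≡⟨ sumTo-cong k (λ i _ → sym (*-assoc (ι (suc i)) (f (suc i)) (g (k ∸ i)))) ⟩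
      (∂ f *S g) k ∎
    right : sumTo (suc k) (λ i → ι (suc k ∸ i) * (f i * g (suc k ∸ i))) ≡ (f *S ∂ g) k
    right = begin
      sumTo k (λ i → ι (suc k ∸ i) * (f i * g (suc k ∸ i)))
        + ι (suc k ∸ suc k) * (f (suc k) * g (suc k ∸ suc k))
        ≡⟨ cong₂ _+_ (sumTo-cong k (λ i i≤k → trans (cong (λ x → ι x * (f i * g x)) (ℕ.+-∸-assoc 1 i≤k))
                       (solve 3 (λ a b c → a :* (b :* c) := b :* (a :* c)) refl
                              (ι (suc (k ∸ i))) (f i) (g (suc (k ∸ i))))))
                     (trans (cong (λ x → ι x * (f (suc k) * g (suc k ∸ suc k))) (ℕ.n∸n≡0 k))
                            (*-zeroˡ (f (suc k) * g (suc k ∸ suc k)))) ⟩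
      (f *S ∂ g) k + 0ℚ
        ≡⟨ +-identityʳ _ ⟩
      (f *S ∂ g) k ∎

  expAt : ℚ → PS
  expAt c = scaleS c expS

  ∂-expAt : ∀ c → ∂ (expAt c) ≈ c ·S expAt c
  ∂-expAt c k = begin
    ι (suc k) * (c * c ^ℚ k * expS (suc k))
      ≡⟨ solve 4 (λ a c d e → a :* (c :* d :* e) := c :* (d :* (a :* e))) refl
               (ι (suc k)) c (c ^ℚ k) (expS (suc k)) ⟩
    c * (c ^ℚ k * (ι (suc k) * expS (suc k)))
      ≡⟨ cong (λ x → c * (c ^ℚ k * x)) (expS-suc k) ⟩
    c * (c ^ℚ k * expS k) ∎

  expAt-unique : ∀ c f → f 0 ≡ 1ℚ → ∂ f ≈ c ·S f → f ≈ expAt c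
  expAt-unique c f f0≡1 ∂f≈cf zero    = f0≡1
  expAt-unique c f f0≡1 ∂f≈cf (suc k) =
    *-cancelˡ-invertible (ℤ.+ 1 ℚ./ suc k) (1/n*ι-n≡1 (suc k))
      (trans (∂f≈cf k) (trans (cong (c *_) (expAt-unique c f f0≡1 ∂f≈cf k)) (sym (∂-expAt c k))))

  expAt-+ : ∀ c d → expAt c *S expAt d ≈ expAt (c + d)
  expAt-+ c d = expAt-unique (c + d) (expAt c *S expAt d) refl ∂-product
    where
    ∂-product : ∂ (expAt c *S expAt d) ≈ (c + d) ·S (expAt c *S expAt d)
    ∂-product k = begin
      ∂ (expAt c *S expAt d) k
        ≡⟨ ∂-*S (expAt c) (expAt d) k ⟩
      (∂ (expAt c) *S expAt d) k + (expAt c *S ∂ (expAt d)) k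
        ≡⟨ cong₂ _+_ (*S-congʳ (expAt d) (∂-expAt c) k) (*S-congˡ (expAt c) (∂-expAt d) k) ⟩
      ((c ·S expAt c) *S expAt d) k + (expAt c *S (d ·S expAt d)) k
        ≡⟨ cong₂ _+_ (·S-*S c (expAt c) (expAt d) k) (*S-·S d (expAt c) (expAt d) k) ⟩
      c * (expAt c *S expAt d) k + d * (expAt c *S expAt d) k
        ≡⟨ sym (*-distribʳ-+ _ c d) ⟩
      (c + d) * (expAt c *S expAt d) k ∎

  expAt-cong : ∀ {c d} → c ≡ d → expAt c ≈ expAt d
  expAt-cong refl = ≈-refl

  expAt-1 : expAt 1ℚ ≈ expS
  expAt-1 k = trans (cong (_* expS k) (1^ℚ k)) (*-identityˡ (expS k))

  expAt-0 : expAt 0ℚ ≈ oneS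
  expAt-0 zero    = refl
  expAt-0 (suc k) = trans (cong (_* expS (suc k)) (*-zeroˡ (0ℚ ^ℚ k))) (*-zeroˡ (expS (suc k)))

  expAt-inverse : ∀ c → expAt c *S expAt (- c) ≈ oneS
  expAt-inverse c = ≈-trans (expAt-+ c (- c)) (≈-trans (expAt-cong (+-inverseʳ c)) expAt-0)

  expAt-ι : ∀ j → expAt (ι j) ≈ powS expS j
  expAt-ι zero    = expAt-0
  expAt-ι (suc j) =
    ≈-trans (expAt-cong (ι-suc j))
    (≈-trans (≈-sym (expAt-+ 1ℚ (ι j))) (*S-cong {expAt 1ℚ} {expS} expAt-1 (expAt-ι j)))

  -- tanh(t/2)

  ½ : ℚ
  ½ = 1/ (ℤ.+ 2 ℚ./ 1)

  two : ℚ
  two = ℤ.+ 2 ℚ./ 1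

  negOne : PS
  negOne = constS (- 1ℚ)

  expM1 : PS
  expM1 = expS +S negOne

  sinhHalf : PS
  sinhHalf = scaleS ½ sinhS

  coshHalf : PS
  coshHalf = scaleS ½ coshS

  -^ℚ : ∀ c k → (- c) ^ℚ k ≡ (- 1ℚ) ^ℚ k * c ^ℚ k
  -^ℚ c k = trans (cong (_^ℚ k) (trans (cong -_ (sym (*-identityˡ c))) (neg-distribˡ-* 1ℚ c)))
                  (^ℚ-* (- 1ℚ) c k)

  negOne-*S : ∀ f → negOne *S f ≈ (- 1ℚ) ·S f
  negOne-*S f = ≈-sym (·S≈constS-*S (- 1ℚ) f)

  sinhHalf≈ : sinhHalf ≈ constS ½ *S (expAt ½ +S (negOne *S expAt (- ½)))
  sinhHalf≈ k = begin
    ½ ^ℚ k * (½ * (expS k + (- 1ℚ) * ((- 1ℚ) ^ℚ k * expS k)))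
      ≡⟨ solve 4 (λ a b s e → b :* (a :* (e :+ (:- con 1ℚ) :* (s :* e)))
                            := a :* (b :* e :+ (:- con 1ℚ) :* ((s :* b) :* e))) refl
               ½ (½ ^ℚ k) ((- 1ℚ) ^ℚ k) (expS k) ⟩
    ½ * (½ ^ℚ k * expS k + (- 1ℚ) * (((- 1ℚ) ^ℚ k * ½ ^ℚ k) * expS k))
      ≡⟨ cong (λ x → ½ * (expAt ½ k + (- 1ℚ) * (x * expS k))) (sym (-^ℚ ½ k)) ⟩
    ½ * (expAt ½ k + (- 1ℚ) * expAt (- ½) k)
      ≡⟨ cong (λ x → ½ * (expAt ½ k + x)) (sym (negOne-*S (expAt (- ½)) k)) ⟩
    (½ ·S (expAt ½ +S (negOne *S expAt (- ½)))) k
      ≡⟨ ·S≈constS-*S ½ (expAt ½ +S (negOne *S expAt (- ½))) k ⟩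
    (constS ½ *S (expAt ½ +S (negOne *S expAt (- ½)))) k ∎

  coshHalf≈ : coshHalf ≈ constS ½ *S (expAt ½ +S expAt (- ½))
  coshHalf≈ k = begin
    ½ ^ℚ k * (½ * (expS k + (- 1ℚ) ^ℚ k * expS k))
      ≡⟨ solve 4 (λ a b s e → b :* (a :* (e :+ s :* e)) := a :* (b :* e :+ (s :* b) :* e)) refl
               ½ (½ ^ℚ k) ((- 1ℚ) ^ℚ k) (expS k) ⟩
    ½ * (½ ^ℚ k * expS k + ((- 1ℚ) ^ℚ k * ½ ^ℚ k) * expS k)
      ≡⟨ cong (λ x → ½ * (expAt ½ k + x * expS k)) (sym (-^ℚ ½ k)) ⟩
    (½ ·S (expAt ½ +S expAt (- ½))) k
      ≡⟨ ·S≈constS-*S ½ (expAt ½ +S expAt (- ½)) k ⟩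
    (constS ½ *S (expAt ½ +S expAt (- ½))) k ∎

  sinhS≈ : sinhS ≈ constS ½ *S (expS +S (negOne *S expAt (- 1ℚ)))
  sinhS≈ k = trans (cong (λ x → ½ * (expS k + x)) (sym (negOne-*S (expAt (- 1ℚ)) k)))
                   (·S≈constS-*S ½ (expS +S (negOne *S expAt (- 1ℚ))) k)

  expAt½² : expAt ½ *S expAt ½ ≈ expS
  expAt½² = ≈-trans (expAt-+ ½ ½) expAt-1

  expS*expAt-1 : expS *S expAt (- 1ℚ) ≈ oneS
  expS*expAt-1 = ≈-trans (*S-congʳ (expAt (- 1ℚ)) (≈-sym expAt-1)) (expAt-inverse 1ℚ)

  1+negOne≈0 : oneS +S negOne ≈ zeroS
  1+negOne≈0 zero    = refl
  1+negOne≈0 (suc k) = refl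

  negOne²≈1 : negOne *S negOne ≈ oneS
  negOne²≈1 = ≈-trans (constS-* (- 1ℚ) (- 1ℚ)) (λ k → *-identityˡ (oneS k))

  two*½≈1 : constS two *S constS ½ ≈ oneS
  two*½≈1 = ≈-trans (constS-* two ½) (λ k → *-identityˡ (oneS k))

  1+1≈two : oneS +S oneS ≈ constS two
  1+1≈two zero    = refl
  1+1≈two (suc k) = refl

  sinhHalf*expP1≈expM1*coshHalf : sinhHalf *S expP1 ≈ expM1 *S coshHalf
  sinhHalf*expP1≈expM1*coshHalf = begin≈
    sinhHalf *S expP1
      ≈⟨ *S-cong {sinhHalf} {H *S (h +S (m *S h̄))} sinhHalf≈
                 (+S-cong {expS} {h *S h} {oneS} {oneS} (≈-sym expAt½²) ≈-refl) ⟩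
    (H *S (h +S (m *S h̄))) *S ((h *S h) +S oneS)
      ≈⟨ S.solve 4 (λ H h h̄ m → (H S.:* (h S.:+ (m S.:* h̄))) S.:* ((h S.:* h) S.:+ S.con 1)
                   S.:= (H S.:* (((h S.:* h) S.:* h) S.:+ h S.:+ (m S.:* h̄))) S.:+ (((H S.:* m) S.:* h) S.:* (h S.:* h̄)))
           ≈-refl H h h̄ m ⟩
    (H *S ((((h *S h) *S h) +S h) +S (m *S h̄))) +S (((H *S m) *S h) *S (h *S h̄))
      ≈⟨ +S-congˡ (H *S ((((h *S h) *S h) +S h) +S (m *S h̄))) (*S-congˡ ((H *S m) *S h) hh̄≈1) ⟩
    (H *S ((((h *S h) *S h) +S h) +S (m *S h̄))) +S (((H *S m) *S h) *S oneS)
      ≈⟨ S.solve 4 (λ H h h̄ m → (H S.:* (((h S.:* h) S.:* h) S.:+ h S.:+ (m S.:* h̄)))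
                                  S.:+ (((H S.:* m) S.:* h) S.:* S.con 1)
                   S.:= (H S.:* (((h S.:* h) S.:* h) S.:+ (m S.:* h) S.:+ (m S.:* h̄))) S.:+ ((H S.:* h) S.:* S.con 1))
           ≈-refl H h h̄ m ⟩
    (H *S ((((h *S h) *S h) +S (m *S h)) +S (m *S h̄))) +S ((H *S h) *S oneS)
      ≈⟨ +S-congˡ (H *S ((((h *S h) *S h) +S (m *S h)) +S (m *S h̄))) (*S-congˡ (H *S h) (≈-sym hh̄≈1)) ⟩
    (H *S ((((h *S h) *S h) +S (m *S h)) +S (m *S h̄))) +S ((H *S h) *S (h *S h̄))
      ≈⟨ S.solve 4 (λ H h h̄ m → (H S.:* (((h S.:* h) S.:* h) S.:+ (m S.:* h) S.:+ (m S.:* h̄)))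
                                  S.:+ ((H S.:* h) S.:* (h S.:* h̄))
                   S.:= ((h S.:* h) S.:+ m) S.:* (H S.:* (h S.:+ h̄)))
           ≈-refl H h h̄ m ⟩
    ((h *S h) +S m) *S (H *S (h +S h̄))
      ≈⟨ *S-cong {(h *S h) +S m} {expM1} (+S-cong {h *S h} {expS} {m} {m} expAt½² ≈-refl) (≈-sym coshHalf≈) ⟩
    expM1 *S coshHalf ∎≈
    where
    H h h̄ m : PS
    H = constS ½
    h = expAt ½
    h̄ = expAt (- ½)
    m = negOne
    hh̄≈1 : h *S h̄ ≈ oneS
    hh̄≈1 = expAt-inverse ½

  tanhHalf*expP1≈expM1 : tanhHalfS *S expP1 ≈ expM1
  tanhHalf*expP1≈expM1 = begin≈
    (sinhHalf *S invS coshHalf) *S expP1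
      ≈⟨ S.solve 3 (λ a b c → (a S.:* b) S.:* c S.:= (a S.:* c) S.:* b) ≈-refl sinhHalf (invS coshHalf) expP1 ⟩
    (sinhHalf *S expP1) *S invS coshHalf
      ≈⟨ *S-congʳ (invS coshHalf) sinhHalf*expP1≈expM1*coshHalf ⟩
    (expM1 *S coshHalf) *S invS coshHalf
      ≈⟨ *S-assoc expM1 coshHalf (invS coshHalf) ⟩
    expM1 *S (coshHalf *S invS coshHalf)
      ≈⟨ ≈-trans (*S-congˡ expM1 (*S-inverseʳ coshHalf)) (*S-identityʳ expM1) ⟩
    expM1 ∎≈

  expM1*expP1≈two*expS*sinhS : expM1 *S expP1 ≈ constS two *S (expS *S sinhS)
  expM1*expP1≈two*expS*sinhS = begin≈
    (e +S m) *S (e +S oneS)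
      ≈⟨ S.solve 2 (λ e m → (e S.:+ m) S.:* (e S.:+ S.con 1) S.:= ((e S.:* e) S.:+ m) S.:+ ((S.con 1 S.:+ m) S.:* e))
           ≈-refl e m ⟩
    ((e *S e) +S m) +S ((oneS +S m) *S e)
      ≈⟨ +S-congˡ ((e *S e) +S m) (≈-trans (*S-congʳ e 1+negOne≈0) (*S-zeroˡ e)) ⟩
    ((e *S e) +S m) +S zeroS
      ≈⟨ +S-identityʳ ((e *S e) +S m) ⟩
    (e *S e) +S m
      ≈⟨ S.solve 2 (λ e m → (e S.:* e) S.:+ m S.:= S.con 1 S.:* ((e S.:* e) S.:+ (m S.:* S.con 1))) ≈-refl e m ⟩
    oneS *S ((e *S e) +S (m *S oneS))
      ≈⟨ *S-cong {oneS} {T *S H} (≈-sym two*½≈1) (+S-congˡ (e *S e) (*S-congˡ m (≈-sym expS*expAt-1))) ⟩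
    (T *S H) *S ((e *S e) +S (m *S (e *S ē)))
      ≈⟨ S.solve 5 (λ e m ē H T → (T S.:* H) S.:* ((e S.:* e) S.:+ (m S.:* (e S.:* ē)))
                   S.:= T S.:* (e S.:* (H S.:* (e S.:+ (m S.:* ē)))))
           ≈-refl e m ē H T ⟩
    T *S (e *S (H *S (e +S (m *S ē))))
      ≈⟨ *S-congˡ T (*S-congˡ e (≈-sym sinhS≈)) ⟩
    T *S (e *S sinhS) ∎≈
    where
    e ē m H T : PS
    e = expS
    ē = expAt (- 1ℚ)
    m = negOne
    H = constS ½
    T = constS two

  1-tanhHalf : PS
  1-tanhHalf = oneS +S ((- 1ℚ) ·S tanhHalfS)

  1-tanhHalf*expP1≈two : 1-tanhHalf *S expP1 ≈ constS two
  1-tanhHalf*expP1≈two = begin≈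
    1-tanhHalf *S expP1
      ≈⟨ *S-congʳ expP1 (+S-congˡ oneS (≈-sym (negOne-*S Z))) ⟩
    (oneS +S (m *S Z)) *S expP1
      ≈⟨ S.solve 3 (λ m z w → (S.con 1 S.:+ (m S.:* z)) S.:* w S.:= w S.:+ (m S.:* (z S.:* w))) ≈-refl m Z expP1 ⟩
    expP1 +S (m *S (Z *S expP1))
      ≈⟨ +S-congˡ expP1 (*S-congˡ m tanhHalf*expP1≈expM1) ⟩
    (expS +S oneS) +S (m *S (expS +S m))
      ≈⟨ S.solve 2 (λ e m → (e S.:+ S.con 1) S.:+ (m S.:* (e S.:+ m))
                   S.:= (S.con 1 S.:+ (m S.:* m)) S.:+ ((S.con 1 S.:+ m) S.:* e)) ≈-refl expS m ⟩
    (oneS +S (m *S m)) +S ((oneS +S m) *S expS)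
      ≈⟨ +S-cong {oneS +S (m *S m)} {oneS +S oneS} (+S-congˡ oneS negOne²≈1)
                 (≈-trans (*S-congʳ expS 1+negOne≈0) (*S-zeroˡ expS)) ⟩
    (oneS +S oneS) +S zeroS
      ≈⟨ ≈-trans (+S-identityʳ (oneS +S oneS)) 1+1≈two ⟩
    constS two ∎≈
    where
    Z m : PS
    Z = tanhHalfS
    m = negOne

  -- Binomial coefficients, rising factorials and Stirling numbers

  -- Pascal's recursion, which computes, unlike Data.Nat.Combinatorics._C_ (defined by division).
  binom : ℕ → ℕ → ℕ
  binom n       zero    = 1
  binom zero    (suc k) = 0
  binom (suc n) (suc k) = binom n k ℕ.+ binom n (suc k)

  rising : ℕ → ℕ → ℕ
  rising x zero    = 1
  rising x (suc n) = rising x n ℕ.* (x ℕ.+ n)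

  binom-1 : ∀ n → binom n 1 ≡ n
  binom-1 zero    = refl
  binom-1 (suc n) = cong suc (binom-1 n)

  binom-> : ∀ n k → n < k → binom n k ≡ 0
  binom-> zero    (suc k) _         = refl
  binom-> (suc n) (suc k) (s≤s n<k) = cong₂ ℕ._+_ (binom-> n k n<k) (binom-> n (suc k) (ℕ.m<n⇒m<1+n n<k))

  binom-n-n : ∀ n → binom n n ≡ 1
  binom-n-n zero    = refl
  binom-n-n (suc n) = cong₂ ℕ._+_ (binom-n-n n) (binom-> n (suc n) (ℕ.n<1+n n))

  1+m*binom≡1+j*binom : ∀ m j → suc m ℕ.* binom m j ≡ suc j ℕ.* binom (suc m) (suc j)
  1+m*binom≡1+j*binom zero    zero    = refl
  1+m*binom≡1+j*binom zero    (suc j) = sym (ℕ.*-zeroʳ (suc (suc j)))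
  1+m*binom≡1+j*binom (suc m) zero    =
    trans (ℕ.*-identityʳ (suc (suc m))) (cong suc (trans (cong suc (sym (binom-1 m))) (sym (ℕ.+-identityʳ _))))
  1+m*binom≡1+j*binom (suc m) (suc j) = begin
    suc (suc m) ℕ.* (a ℕ.+ b)
      ≡⟨ expand m a b ⟩
    suc m ℕ.* a ℕ.+ (a ℕ.+ b) ℕ.+ suc m ℕ.* b
      ≡⟨ cong₂ (λ x y → x ℕ.+ (a ℕ.+ b) ℕ.+ y) (1+m*binom≡1+j*binom m j) (1+m*binom≡1+j*binom m (suc j)) ⟩
    suc j ℕ.* (a ℕ.+ b) ℕ.+ (a ℕ.+ b) ℕ.+ suc (suc j) ℕ.* c
      ≡⟨ collect j (a ℕ.+ b) c ⟩
    suc (suc j) ℕ.* ((a ℕ.+ b) ℕ.+ c) ∎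
    where
    a b c : ℕ
    a = binom m j
    b = binom m (suc j)
    c = binom (suc m) (suc (suc j))
    expand : ∀ m a b → suc (suc m) ℕ.* (a ℕ.+ b) ≡ suc m ℕ.* a ℕ.+ (a ℕ.+ b) ℕ.+ suc m ℕ.* b
    expand = solve-∀
    collect : ∀ j s c → suc j ℕ.* s ℕ.+ s ℕ.+ suc (suc j) ℕ.* c ≡ suc (suc j) ℕ.* (s ℕ.+ c)
    collect = solve-∀

  binom*rising*!≡!*binom : ∀ n r d →
    binom (r ℕ.+ d) r ℕ.* rising (suc (r ℕ.+ d)) n ℕ.* r ! ≡ (n ℕ.+ r) ! ℕ.* binom (d ℕ.+ (n ℕ.+ r)) (n ℕ.+ r)
  binom*rising*!≡!*binom zero    r d = begin
    binom (r ℕ.+ d) r ℕ.* 1 ℕ.* r !   ≡⟨ cong (λ x → binom x r ℕ.* 1 ℕ.* r !) (ℕ.+-comm r d) ⟩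
    binom (d ℕ.+ r) r ℕ.* 1 ℕ.* r !   ≡⟨ swap (binom (d ℕ.+ r) r) (r !) ⟩
    r ! ℕ.* binom (d ℕ.+ r) r         ∎
    where
    swap : ∀ a b → a ℕ.* 1 ℕ.* b ≡ b ℕ.* a
    swap = solve-∀
  binom*rising*!≡!*binom (suc n) r d = begin
    binom (r ℕ.+ d) r ℕ.* (rising (suc (r ℕ.+ d)) n ℕ.* (suc (r ℕ.+ d) ℕ.+ n)) ℕ.* r !
      ≡⟨ regroup (binom (r ℕ.+ d) r) (rising (suc (r ℕ.+ d)) n) (suc (r ℕ.+ d) ℕ.+ n) (r !) ⟩
    (binom (r ℕ.+ d) r ℕ.* rising (suc (r ℕ.+ d)) n ℕ.* r !) ℕ.* (suc (r ℕ.+ d) ℕ.+ n)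
      ≡⟨ cong₂ ℕ._*_ (binom*rising*!≡!*binom n r d) (cong suc (reorder r d n)) ⟩
    (j ! ℕ.* binom m j) ℕ.* suc m
      ≡⟨ swap (j !) (binom m j) (suc m) ⟩
    j ! ℕ.* (suc m ℕ.* binom m j)
      ≡⟨ cong (j ! ℕ.*_) (1+m*binom≡1+j*binom m j) ⟩
    j ! ℕ.* (suc j ℕ.* binom (suc m) (suc j))
      ≡⟨ sym (ℕ.*-assoc (j !) (suc j) _) ⟩
    j ! ℕ.* suc j ℕ.* binom (suc m) (suc j)
      ≡⟨ cong₂ (λ x y → x ℕ.* binom y (suc j)) (ℕ.*-comm (j !) (suc j)) (sym (ℕ.+-suc d (n ℕ.+ r))) ⟩
    (suc n ℕ.+ r) ! ℕ.* binom (d ℕ.+ (suc n ℕ.+ r)) (suc n ℕ.+ r) ∎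
    where
    m j : ℕ
    m = d ℕ.+ (n ℕ.+ r)
    j = n ℕ.+ r
    regroup : ∀ a b c f → a ℕ.* (b ℕ.* c) ℕ.* f ≡ (a ℕ.* b ℕ.* f) ℕ.* c
    regroup = solve-∀
    reorder : ∀ r d n → r ℕ.+ d ℕ.+ n ≡ d ℕ.+ (n ℕ.+ r)
    reorder = solve-∀
    swap : ∀ a b c → (a ℕ.* b) ℕ.* c ≡ a ℕ.* (c ℕ.* b)
    swap = solve-∀

  stirling1-> : ∀ n j → n < j → stirling1 n j ≡ 0
  stirling1-> zero    (suc j) _         = refl
  stirling1-> (suc n) (suc j) (s≤s n<j) =
    trans (cong₂ ℕ._+_ (cong (n ℕ.*_) (stirling1-> n (suc j) (ℕ.m<n⇒m<1+n n<j))) (stirling1-> n j n<j))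
          (cong (ℕ._+ 0) (ℕ.*-zeroʳ n))

  n*stirling1-n-0≡0 : ∀ n → n ℕ.* stirling1 n 0 ≡ 0
  n*stirling1-n-0≡0 zero    = refl
  n*stirling1-n-0≡0 (suc n) = ℕ.*-zeroʳ (suc n)

  risingℚ : ℚ → ℕ → ℚ
  risingℚ y zero    = 1ℚ
  risingℚ y (suc n) = risingℚ y n * (y + ι n)

  risingℚ-ι : ∀ x n → risingℚ (ι x) n ≡ ι (rising x n)
  risingℚ-ι x zero    = refl
  risingℚ-ι x (suc n) = trans (cong₂ _*_ (risingℚ-ι x n) (sym (ι-+ x n))) (sym (ι-* (rising x n) (x ℕ.+ n)))

  stirlingPoly : ℕ → ℚ → ℚ
  stirlingPoly n y = sumTo n (λ j → ι (stirling1 n j) * y ^ℚ j)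

  ι-n*stirlingPoly : ∀ n y →
    ι n * sumTo n (λ j → ι (stirling1 n (suc j)) * y ^ℚ suc j) ≡ ι n * stirlingPoly n y
  ι-n*stirlingPoly n y = begin
    ι n * Σ'
      ≡⟨ sym (+-identityˡ _) ⟩
    0ℚ + ι n * Σ'
      ≡⟨ cong (_+ ι n * Σ') (sym n*s₀≡0) ⟩
    ι n * (ι (stirling1 n 0) * 1ℚ) + ι n * Σ'
      ≡⟨ sym (*-distribˡ-+ (ι n) _ Σ') ⟩
    ι n * (ι (stirling1 n 0) * 1ℚ + Σ')
      ≡⟨ cong (ι n *_) (sym (sumTo-head n (λ j → ι (stirling1 n j) * y ^ℚ j))) ⟩
    ι n * (stirlingPoly n y + ι (stirling1 n (suc n)) * y ^ℚ suc n)
      ≡⟨ cong (λ x → ι n * (stirlingPoly n y + ι x * y ^ℚ suc n)) (stirling1-> n (suc n) (ℕ.n<1+n n)) ⟩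
    ι n * (stirlingPoly n y + 0ℚ * y ^ℚ suc n)
      ≡⟨ cong (λ x → ι n * (stirlingPoly n y + x)) (*-zeroˡ (y ^ℚ suc n)) ⟩
    ι n * (stirlingPoly n y + 0ℚ)
      ≡⟨ cong (ι n *_) (+-identityʳ (stirlingPoly n y)) ⟩
    ι n * stirlingPoly n y ∎
    where
    Σ' : ℚ
    Σ' = sumTo n (λ j → ι (stirling1 n (suc j)) * y ^ℚ suc j)
    n*s₀≡0 : ι n * (ι (stirling1 n 0) * 1ℚ) ≡ 0ℚ
    n*s₀≡0 = begin
      ι n * (ι (stirling1 n 0) * 1ℚ)   ≡⟨ cong (ι n *_) (*-identityʳ _) ⟩
      ι n * ι (stirling1 n 0)          ≡⟨ sym (ι-* n (stirling1 n 0)) ⟩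
      ι (n ℕ.* stirling1 n 0)          ≡⟨ cong ι (n*stirling1-n-0≡0 n) ⟩
      0ℚ                               ∎

  stirlingPoly≡risingℚ : ∀ n y → stirlingPoly n y ≡ risingℚ y n
  stirlingPoly≡risingℚ zero    y = refl
  stirlingPoly≡risingℚ (suc n) y = begin
    sumTo (suc n) (λ j → ι (stirling1 (suc n) j) * y ^ℚ j)
      ≡⟨ sumTo-head n _ ⟩
    0ℚ + sumTo n (λ j → ι (n ℕ.* stirling1 n (suc j) ℕ.+ stirling1 n j) * (y * y ^ℚ j))
      ≡⟨ +-identityˡ _ ⟩
    sumTo n (λ j → ι (n ℕ.* stirling1 n (suc j) ℕ.+ stirling1 n j) * (y * y ^ℚ j))
      ≡⟨ sumTo-cong n (λ j _ → term j) ⟩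
    sumTo n (λ j → ι n * (ι (stirling1 n (suc j)) * y ^ℚ suc j) + y * (ι (stirling1 n j) * y ^ℚ j))
      ≡⟨ sumTo-+ n _ _ ⟩
    sumTo n (λ j → ι n * (ι (stirling1 n (suc j)) * y ^ℚ suc j)) + sumTo n (λ j → y * (ι (stirling1 n j) * y ^ℚ j))
      ≡⟨ cong₂ _+_ (sym (sumTo-*ˡ n (ι n) _)) (sym (sumTo-*ˡ n y _)) ⟩
    ι n * sumTo n (λ j → ι (stirling1 n (suc j)) * y ^ℚ suc j) + y * stirlingPoly n y
      ≡⟨ cong (_+ y * stirlingPoly n y) (ι-n*stirlingPoly n y) ⟩
    ι n * stirlingPoly n y + y * stirlingPoly n y
      ≡⟨ solve 3 (λ a s y → a :* s :+ y :* s := s :* (y :+ a)) refl (ι n) (stirlingPoly n y) y ⟩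
    stirlingPoly n y * (y + ι n)
      ≡⟨ cong (_* (y + ι n)) (stirlingPoly≡risingℚ n y) ⟩
    risingℚ y n * (y + ι n) ∎
    where
    term : ∀ j → ι (n ℕ.* stirling1 n (suc j) ℕ.+ stirling1 n j) * (y * y ^ℚ j)
               ≡ ι n * (ι (stirling1 n (suc j)) * y ^ℚ suc j) + y * (ι (stirling1 n j) * y ^ℚ j)
    term j = begin
      ι (n ℕ.* stirling1 n (suc j) ℕ.+ stirling1 n j) * (y * y ^ℚ j)
        ≡⟨ cong (_* (y * y ^ℚ j)) (trans (ι-+ (n ℕ.* stirling1 n (suc j)) (stirling1 n j))
                                         (cong (_+ ι (stirling1 n j)) (ι-* n (stirling1 n (suc j))))) ⟩
      (ι n * ι (stirling1 n (suc j)) + ι (stirling1 n j)) * (y * y ^ℚ j)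
        ≡⟨ solve 5 (λ a b c y z → (a :* b :+ c) :* (y :* z) := a :* (b :* (y :* z)) :+ y :* (c :* z)) refl
                 (ι n) (ι (stirling1 n (suc j))) (ι (stirling1 n j)) y (y ^ℚ j) ⟩
      ι n * (ι (stirling1 n (suc j)) * y ^ℚ suc j) + y * (ι (stirling1 n j) * y ^ℚ j) ∎

  -- The closed form of Σ_j [n j] Li_{-l-j}(z)

  1-X*S-suc : ∀ f k → (1-X *S f) (suc k) ≡ f (suc k) + (- 1ℚ) * f k
  1-X*S-suc f k = begin
    (1-X *S f) (suc k)
      ≡⟨ sumTo-head k _ ⟩
    1ℚ * f (suc k) + sumTo k (λ i → 1-X (suc i) * f (k ∸ i))
      ≡⟨ cong₂ _+_ (*-identityˡ (f (suc k))) (sumTo-extend _ z≤n higher) ⟩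
    f (suc k) + (- 1ℚ) * f k ∎
    where
    higher : ∀ j → 0 < j → j ≤ k → 1-X (suc j) * f (k ∸ j) ≡ 0ℚ
    higher (suc j) _ _ = *-zeroˡ (f (k ∸ suc j))

  -- the coefficients of (1 − X)^{-(N+1)}
  negBinomS : ℕ → PS
  negBinomS N k = ι (binom (k ℕ.+ N) N)

  1-X*negBinomS-suc : ∀ N → 1-X *S negBinomS (suc N) ≈ negBinomS N
  1-X*negBinomS-suc N zero    = trans (*-identityˡ _) (cong ι (trans (binom-n-n (suc N)) (sym (binom-n-n N))))
  1-X*negBinomS-suc N (suc k) = begin
    (1-X *S negBinomS (suc N)) (suc k)
      ≡⟨ 1-X*S-suc (negBinomS (suc N)) k ⟩
    ι (binom (k ℕ.+ suc N) N ℕ.+ binom (k ℕ.+ suc N) (suc N)) + (- 1ℚ) * ι (binom (k ℕ.+ suc N) (suc N))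
      ≡⟨ cong (_+ (- 1ℚ) * ι (binom (k ℕ.+ suc N) (suc N))) (ι-+ (binom (k ℕ.+ suc N) N) _) ⟩
    (ι (binom (k ℕ.+ suc N) N) + ι (binom (k ℕ.+ suc N) (suc N))) + (- 1ℚ) * ι (binom (k ℕ.+ suc N) (suc N))
      ≡⟨ solve 2 (λ a b → (a :+ b) :+ (:- con 1ℚ) :* b := a) refl
               (ι (binom (k ℕ.+ suc N) N)) (ι (binom (k ℕ.+ suc N) (suc N))) ⟩
    ι (binom (k ℕ.+ suc N) N)
      ≡⟨ cong (λ x → ι (binom x N)) (ℕ.+-suc k N) ⟩
    negBinomS N (suc k) ∎

  powS-1-X*negBinomS≈1 : ∀ N → powS 1-X (suc N) *S negBinomS N ≈ oneS
  powS-1-X*negBinomS≈1 zero    =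
    ≈-trans (*S-congʳ (negBinomS 0) (*S-identityʳ 1-X)) 1-X*geometricS≈1
  powS-1-X*negBinomS≈1 (suc N) = begin≈
    (1-X *S powS 1-X (suc N)) *S negBinomS (suc N)
      ≈⟨ S.solve 3 (λ a p b → (a S.:* p) S.:* b S.:= p S.:* (a S.:* b))
           ≈-refl 1-X (powS 1-X (suc N)) (negBinomS (suc N)) ⟩
    powS 1-X (suc N) *S (1-X *S negBinomS (suc N))
      ≈⟨ *S-congˡ (powS 1-X (suc N)) (1-X*negBinomS-suc N) ⟩
    powS 1-X (suc N) *S negBinomS N
      ≈⟨ powS-1-X*negBinomS≈1 N ⟩
    oneS ∎≈

  tanhHalf0≡0 : tanhHalfS 0 ≡ 0ℚ
  tanhHalf0≡0 = refl

  invPow1-tanhHalf : ℕ → PS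
  invPow1-tanhHalf N = compose (negBinomS N) tanhHalfS

  powS-1-tanhHalf*invPow≈1 : ∀ N → powS 1-tanhHalf (suc N) *S invPow1-tanhHalf N ≈ oneS
  powS-1-tanhHalf*invPow≈1 N = begin≈
    powS 1-tanhHalf (suc N) *S compose (negBinomS N) Z
      ≈⟨ *S-congʳ (compose (negBinomS N) Z)
           (≈-trans (powS-cong (suc N) (≈-sym (compose-1-X Z tanhHalf0≡0)))
                    (≈-sym (compose-powS 1-X Z tanhHalf0≡0 (suc N)))) ⟩
    compose (powS 1-X (suc N)) Z *S compose (negBinomS N) Z
      ≈⟨ ≈-sym (compose-*S (powS 1-X (suc N)) (negBinomS N) Z tanhHalf0≡0) ⟩
    compose (powS 1-X (suc N) *S negBinomS N) Z
      ≈⟨ ≈-trans (compose-congˡ Z (powS-1-X*negBinomS≈1 N)) (compose-oneS Z) ⟩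
    oneS ∎≈
    where
    Z : PS
    Z = tanhHalfS

  X*S-suc : ∀ f k → (X *S f) (suc k) ≡ f k
  X*S-suc f k = begin
    (X *S f) (suc k)
      ≡⟨ sumTo-head k _ ⟩
    0ℚ * f (suc k) + sumTo k (λ i → X (suc i) * f (k ∸ i))
      ≡⟨ cong₂ _+_ (*-zeroˡ (f (suc k))) (sumTo-extend _ z≤n higher) ⟩
    0ℚ + 1ℚ * f k
      ≡⟨ trans (+-identityˡ _) (*-identityˡ (f k)) ⟩
    f k ∎
    where
    higher : ∀ j → 0 < j → j ≤ k → X (suc j) * f (k ∸ j) ≡ 0ℚ
    higher (suc j) _ _ = *-zeroˡ (f (k ∸ suc j))

  powS-X*S-≥ : ∀ m k f → m ≤ k → (powS X m *S f) k ≡ f (k ∸ m)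
  powS-X*S-≥ zero    k       f _         = *S-identityˡ f k
  powS-X*S-≥ (suc m) (suc k) f (s≤s m≤k) =
    trans (*S-assoc X (powS X m) f (suc k)) (trans (X*S-suc (powS X m *S f) k) (powS-X*S-≥ m k f m≤k))

  powS-X*S-< : ∀ m k f → k < m → (powS X m *S f) k ≡ 0ℚ
  powS-X*S-< (suc m) zero    f _         = trans (*S-assoc X (powS X m) f 0) (*-zeroˡ ((powS X m *S f) 0))
  powS-X*S-< (suc m) (suc k) f (s≤s k<m) =
    trans (*S-assoc X (powS X m) f (suc k)) (trans (X*S-suc (powS X m *S f) k) (powS-X*S-< m k f k<m))

  compose-powS-X*S : ∀ m f u → u 0 ≡ 0ℚ → compose (powS X m *S f) u ≈ powS u m *S compose f u
  compose-powS-X*S m f u u0≡0 =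
    ≈-trans (compose-*S (powS X m) f u u0≡0)
            (*S-congʳ (compose f u) (≈-trans (compose-powS X u u0≡0 m) (powS-cong m (compose-X u u0≡0))))

  expExpM1Pow : ℕ → PS
  expExpM1Pow r = expS *S powS expM1 r

  expM1-0 : expM1 0 ≡ 0ℚ
  expM1-0 = refl

  *S-compose : ∀ g a u → u 0 ≡ 0ℚ → ∀ l → (g *S compose a u) l ≡ sumTo l (λ j → a j * (g *S powS u j) l)
  *S-compose g a u u0≡0 l = begin
    sumTo l (λ i → g i * compose a u (l ∸ i))
      ≡⟨ sumTo-cong l (λ i _ → trans (cong (g i *_) (compose-extend a u0≡0 (ℕ.m∸n≤m l i))) (sumTo-*ˡ l (g i) _)) ⟩
    sumTo l (λ i → sumTo l (λ j → g i * (a j * powS u j (l ∸ i))))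
      ≡⟨ sumTo-swap l l _ ⟩
    sumTo l (λ j → sumTo l (λ i → g i * (a j * powS u j (l ∸ i))))
      ≡⟨ sumTo-cong l (λ j _ → trans (sumTo-cong l (λ i _ → solve 3 (λ x y z → x :* (y :* z) := y :* (x :* z)) refl
                                                                     (g i) (a j) (powS u j (l ∸ i))))
                                     (sym (sumTo-*ˡ l (a j) _))) ⟩
    sumTo l (λ j → a j * (g *S powS u j) l) ∎

  binomS : ℕ → PS
  binomS q k = ι (binom q k)

  1+X : PS
  1+X = oneS +S X

  powS-1+X≈binomS : ∀ q → powS 1+X q ≈ binomS q
  powS-1+X≈binomS zero    zero    = refl
  powS-1+X≈binomS zero    (suc k) = refl
  powS-1+X≈binomS (suc q) = ≈-trans (*S-congˡ 1+X (powS-1+X≈binomS q)) pascal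
    where
    pascal : 1+X *S binomS q ≈ binomS (suc q)
    pascal k = trans (*S-distribʳ (binomS q) oneS X k) (row k)
      where
      row : ∀ k → ((oneS *S binomS q) +S (X *S binomS q)) k ≡ binomS (suc q) k
      row zero    = trans (cong₂ _+_ (*S-identityˡ (binomS q) 0) (*-zeroˡ (binomS q 0))) (+-identityʳ _)
      row (suc k) = trans (cong₂ _+_ (*S-identityˡ (binomS q) (suc k)) (X*S-suc (binomS q) k))
                          (trans (+-comm (ι (binom q (suc k))) (ι (binom q k)))
                                 (sym (ι-+ (binom q k) (binom q (suc k)))))

  powS-expS≈compose-binomS : ∀ q → powS expS q ≈ compose (binomS q) expM1
  powS-expS≈compose-binomS q = begin≈
    powS expS q
      ≈⟨ powS-cong q expS≈1+expM1 ⟩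
    powS (oneS +S expM1) q
      ≈⟨ powS-cong q (≈-sym compose-1+X) ⟩
    powS (compose 1+X expM1) q
      ≈⟨ ≈-sym (compose-powS 1+X expM1 expM1-0 q) ⟩
    compose (powS 1+X q) expM1
      ≈⟨ compose-congˡ expM1 (powS-1+X≈binomS q) ⟩
    compose (binomS q) expM1 ∎≈
    where
    expS≈1+expM1 : expS ≈ oneS +S expM1
    expS≈1+expM1 k = solve 2 (λ e o → e := o :+ (e :+ (:- con 1ℚ) :* o)) refl (expS k) (oneS k)
    compose-1+X : compose 1+X expM1 ≈ oneS +S expM1
    compose-1+X = ≈-trans (compose-+S oneS X expM1)
                          (+S-cong {compose oneS expM1} {oneS} (compose-oneS expM1) (compose-X expM1 expM1-0))

  ι-suc-^≡sum-binom-expExpM1Pow : ∀ q l →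
    ι (suc q ℕ.^ l) ≡ ι (l !) * sumTo l (λ r → ι (binom q r) * expExpM1Pow r l)
  ι-suc-^≡sum-binom-expExpM1Pow q l = begin
    ι (suc q ℕ.^ l)
      ≡⟨ ι-^ (suc q) l ⟩
    ι (suc q) ^ℚ l
      ≡⟨ sym (*-identityʳ _) ⟩
    ι (suc q) ^ℚ l * 1ℚ
      ≡⟨ cong (ι (suc q) ^ℚ l *_) (sym (expS*ι!≡1 l)) ⟩
    ι (suc q) ^ℚ l * (expS l * ι (l !))
      ≡⟨ solve 3 (λ a b c → a :* (b :* c) := c :* (a :* b)) refl (ι (suc q) ^ℚ l) (expS l) (ι (l !)) ⟩
    ι (l !) * expAt (ι (suc q)) l
      ≡⟨ cong (ι (l !) *_) binomial ⟩
    ι (l !) * sumTo l (λ r → ι (binom q r) * expExpM1Pow r l) ∎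
    where
    binomial : expAt (ι (suc q)) l ≡ sumTo l (λ r → ι (binom q r) * expExpM1Pow r l)
    binomial = begin
      expAt (ι (suc q)) l                              ≡⟨ expAt-ι (suc q) l ⟩
      (expS *S powS expS q) l                          ≡⟨ *S-congˡ expS (powS-expS≈compose-binomS q) l ⟩
      (expS *S compose (binomS q) expM1) l             ≡⟨ *S-compose expS (binomS q) expM1 expM1-0 l ⟩
      sumTo l (λ r → ι (binom q r) * expExpM1Pow r l) ∎

  module _ (n : ℕ) where

    stirlingLi : ℕ → PS
    stirlingLi l = sumS n (λ j → ι (stirling1 n j) ·S liCoeff (l ℕ.+ j))

    weight : ℕ → ℕ → ℚ
    weight l r = expExpM1Pow r l * ι ((n ℕ.+ r) !) * expS r

    liTerm : ℕ → PS
    liTerm r = powS X (suc r) *S negBinomS (n ℕ.+ r)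

    weight*liTerm-suc : ∀ l q r → weight l r * liTerm r (suc q) ≡ ι (rising (suc q) n) * (ι (binom q r) * expExpM1Pow r l)
    weight*liTerm-suc l q r with r ℕ.≤? q
    ... | yes r≤q = begin
        F * ι ((n ℕ.+ r) !) * expS r * liTerm r (suc q)
          ≡⟨ cong (F * ι ((n ℕ.+ r) !) * expS r *_) (powS-X*S-≥ (suc r) (suc q) (negBinomS (n ℕ.+ r)) (s≤s r≤q)) ⟩
        F * ι ((n ℕ.+ r) !) * expS r * ι (binom ((q ∸ r) ℕ.+ (n ℕ.+ r)) (n ℕ.+ r))
          ≡⟨ solve 4 (λ a b c d → a :* b :* c :* d := (a :* c) :* (b :* d)) refl
                   F (ι ((n ℕ.+ r) !)) (expS r) (ι (binom ((q ∸ r) ℕ.+ (n ℕ.+ r)) (n ℕ.+ r))) ⟩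
        (F * expS r) * (ι ((n ℕ.+ r) !) * ι (binom ((q ∸ r) ℕ.+ (n ℕ.+ r)) (n ℕ.+ r)))
          ≡⟨ cong ((F * expS r) *_) (sym (ι-* ((n ℕ.+ r) !) _)) ⟩
        (F * expS r) * ι ((n ℕ.+ r) ! ℕ.* binom ((q ∸ r) ℕ.+ (n ℕ.+ r)) (n ℕ.+ r))
          ≡⟨ cong (λ x → (F * expS r) * ι x) (sym identity) ⟩
        (F * expS r) * ι (binom q r ℕ.* rising (suc q) n ℕ.* r !)
          ≡⟨ cong ((F * expS r) *_) (trans (ι-* (binom q r ℕ.* rising (suc q) n) (r !))
                                           (cong (_* ι (r !)) (ι-* (binom q r) (rising (suc q) n)))) ⟩
        (F * expS r) * (ι (binom q r) * ι (rising (suc q) n) * ι (r !))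
          ≡⟨ solve 5 (λ f e b s t → (f :* e) :* (b :* s :* t) := s :* (b :* f) :* (e :* t)) refl
                   F (expS r) (ι (binom q r)) (ι (rising (suc q) n)) (ι (r !)) ⟩
        ι (rising (suc q) n) * (ι (binom q r) * F) * (expS r * ι (r !))
          ≡⟨ trans (cong (ι (rising (suc q) n) * (ι (binom q r) * F) *_) (expS*ι!≡1 r)) (*-identityʳ _) ⟩
        ι (rising (suc q) n) * (ι (binom q r) * F) ∎
      where
      F : ℚ
      F = expExpM1Pow r l
      identity : binom q r ℕ.* rising (suc q) n ℕ.* r ! ≡ (n ℕ.+ r) ! ℕ.* binom ((q ∸ r) ℕ.+ (n ℕ.+ r)) (n ℕ.+ r)
      identity = subst (λ x → binom x r ℕ.* rising (suc x) n ℕ.* r !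
                              ≡ (n ℕ.+ r) ! ℕ.* binom ((q ∸ r) ℕ.+ (n ℕ.+ r)) (n ℕ.+ r))
                       (ℕ.m+[n∸m]≡n r≤q) (binom*rising*!≡!*binom n r (q ∸ r))
    ... | no r≰q = begin
        weight l r * liTerm r (suc q)
          ≡⟨ cong (weight l r *_) (powS-X*S-< (suc r) (suc q) (negBinomS (n ℕ.+ r)) (s≤s (ℕ.≰⇒> r≰q))) ⟩
        weight l r * 0ℚ
          ≡⟨ *-zeroʳ (weight l r) ⟩
        0ℚ
          ≡⟨ sym (*-zeroʳ (ι (rising (suc q) n))) ⟩
        ι (rising (suc q) n) * 0ℚ
          ≡⟨ cong (ι (rising (suc q) n) *_) (sym (trans (cong (λ x → ι x * expExpM1Pow r l) (binom-> q r (ℕ.≰⇒> r≰q)))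
                                                         (*-zeroˡ (expExpM1Pow r l)))) ⟩
        ι (rising (suc q) n) * (ι (binom q r) * expExpM1Pow r l) ∎

    stirlingLi≈ : ∀ l → stirlingLi l ≈ ι (l !) ·S sumS l (λ r → weight l r ·S liTerm r)
    stirlingLi≈ l zero    = begin
      sumTo n (λ j → ι (stirling1 n j) * 0ℚ)
        ≡⟨ sumTo-zero n _ (λ j _ → *-zeroʳ (ι (stirling1 n j))) ⟩
      0ℚ
        ≡⟨ sym (*-zeroʳ (ι (l !))) ⟩
      ι (l !) * 0ℚ
        ≡⟨ cong (ι (l !) *_) (sym (sumTo-zero l _ (λ r _ → trans (cong (weight l r *_)
                                    (powS-X*S-< (suc r) 0 (negBinomS (n ℕ.+ r)) (s≤s z≤n))) (*-zeroʳ (weight l r))))) ⟩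
      (ι (l !) ·S sumS l (λ r → weight l r ·S liTerm r)) 0 ∎
    stirlingLi≈ l (suc q) = begin
      sumTo n (λ j → ι (stirling1 n j) * ι (suc q ℕ.^ (l ℕ.+ j)))
        ≡⟨ sumTo-cong n (λ j _ → cong (ι (stirling1 n j) *_) (power j)) ⟩
      sumTo n (λ j → ι (stirling1 n j) * (ι (suc q ℕ.^ l) * ι (suc q) ^ℚ j))
        ≡⟨ sumTo-cong n (λ j _ → solve 3 (λ a b c → a :* (b :* c) := b :* (a :* c)) refl
                                         (ι (stirling1 n j)) (ι (suc q ℕ.^ l)) (ι (suc q) ^ℚ j)) ⟩
      sumTo n (λ j → ι (suc q ℕ.^ l) * (ι (stirling1 n j) * ι (suc q) ^ℚ j))
        ≡⟨ sym (sumTo-*ˡ n (ι (suc q ℕ.^ l)) _) ⟩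
      ι (suc q ℕ.^ l) * stirlingPoly n (ι (suc q))
        ≡⟨ cong₂ _*_ (ι-suc-^≡sum-binom-expExpM1Pow q l)
                     (trans (stirlingPoly≡risingℚ n (ι (suc q))) (risingℚ-ι (suc q) n)) ⟩
      ι (l !) * sumTo l (λ r → ι (binom q r) * expExpM1Pow r l) * ι (rising (suc q) n)
        ≡⟨ solve 3 (λ a s b → a :* s :* b := a :* (b :* s)) refl
                 (ι (l !)) (sumTo l (λ r → ι (binom q r) * expExpM1Pow r l)) (ι (rising (suc q) n)) ⟩
      ι (l !) * (ι (rising (suc q) n) * sumTo l (λ r → ι (binom q r) * expExpM1Pow r l))
        ≡⟨ cong (ι (l !) *_) (trans (sumTo-*ˡ l (ι (rising (suc q) n)) _)
                                    (sumTo-cong l (λ r _ → sym (weight*liTerm-suc l q r)))) ⟩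
      (ι (l !) ·S sumS l (λ r → weight l r ·S liTerm r)) (suc q) ∎
      where
      power : ∀ j → ι (suc q ℕ.^ (l ℕ.+ j)) ≡ ι (suc q ℕ.^ l) * ι (suc q) ^ℚ j
      power j = trans (cong ι (ℕ.^-distribˡ-+-* (suc q) l j))
                      (trans (ι-* (suc q ℕ.^ l) (suc q ℕ.^ j)) (cong (ι (suc q ℕ.^ l) *_) (ι-^ (suc q) j)))

  -- The generating function term by term

  -- Φ n G = (e^t + 1)^{1-n} G / sinh t, so that polycscF l n = Φ n (Li_{-l}(tanh(t/2))).
  Φ : ℕ → PS → PS
  Φ n G = expP1Pow1m n *S (divT G *S invS (divT sinhS))

  Φ-cong : ∀ n {G G'} → G ≈ G' → Φ n G ≈ Φ n G'
  Φ-cong n G≈G' = *S-congˡ (expP1Pow1m n) (*S-congʳ (invS (divT sinhS)) (divT-cong G≈G'))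

  Φ-·S : ∀ n c G → Φ n (c ·S G) ≈ c ·S Φ n G
  Φ-·S n c G = ≈-trans (*S-congˡ (expP1Pow1m n) (·S-*S c (divT G) (invS (divT sinhS))))
                       (*S-·S c (expP1Pow1m n) (divT G *S invS (divT sinhS)))

  Φ-sumS : ∀ n L (g : ℕ → PS) → Φ n (sumS L g) ≈ sumS L (λ r → Φ n (g r))
  Φ-sumS n L g = ≈-trans (*S-congˡ (expP1Pow1m n) (sumS-*S L (λ r → divT (g r)) (invS (divT sinhS))))
                         (*S-sumS L (expP1Pow1m n) (λ r → divT (g r) *S invS (divT sinhS)))

  expP1Pow1m*powS-expP1≈expP1 : ∀ n → expP1Pow1m n *S powS expP1 n ≈ expP1
  expP1Pow1m*powS-expP1≈expP1 zero    = *S-identityʳ expP1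
  expP1Pow1m*powS-expP1≈expP1 (suc k) = begin≈
    powS (invS expP1) k *S (expP1 *S powS expP1 k)
      ≈⟨ S.solve 3 (λ a w b → a S.:* (w S.:* b) S.:= w S.:* (b S.:* a))
           ≈-refl (powS (invS expP1) k) expP1 (powS expP1 k) ⟩
    expP1 *S (powS expP1 k *S powS (invS expP1) k)
      ≈⟨ *S-congˡ expP1 (powS-inverse (*S-inverseʳ expP1) k) ⟩
    expP1 *S oneS
      ≈⟨ *S-identityʳ expP1 ⟩
    expP1 ∎≈

  ½^*two^≡1 : ∀ N → ½ ^ℚ N * two ^ℚ N ≡ 1ℚ
  ½^*two^≡1 N = trans (sym (^ℚ-* ½ two N)) (1^ℚ N)

  invPow1-tanhHalf≈ : ∀ N → invPow1-tanhHalf N ≈ (½ ^ℚ suc N) ·S powS expP1 (suc N)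
  invPow1-tanhHalf≈ N = ≈-sym (begin≈
    c ·S W
      ≈⟨ ·S-cong c (≈-trans (≈-sym (*S-identityʳ W)) (*S-congˡ W (≈-sym (powS-1-tanhHalf*invPow≈1 N)))) ⟩
    c ·S (W *S (O *S Q))
      ≈⟨ ·S-cong c (S.solve 3 (λ w o q → w S.:* (o S.:* q) S.:= (o S.:* w) S.:* q) ≈-refl W O Q) ⟩
    c ·S ((O *S W) *S Q)
      ≈⟨ ·S-cong c (*S-congʳ Q (≈-trans (≈-sym (powS-* 1-tanhHalf expP1 (suc N)))
                                        (≈-trans (powS-cong (suc N) 1-tanhHalf*expP1≈two) (powS-constS two (suc N))))) ⟩
    c ·S (constS (two ^ℚ suc N) *S Q)
      ≈⟨ ·S-cong c (≈-sym (·S≈constS-*S (two ^ℚ suc N) Q)) ⟩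
    c ·S ((two ^ℚ suc N) ·S Q)
      ≈⟨ ·S-·S c (two ^ℚ suc N) Q ⟩
    (c * two ^ℚ suc N) ·S Q
      ≈⟨ (λ k → trans (cong (_* Q k) (½^*two^≡1 (suc N))) (*-identityˡ (Q k))) ⟩
    Q ∎≈)
    where
    c : ℚ
    c = ½ ^ℚ suc N
    W O Q : PS
    W = powS expP1 (suc N)
    O = powS 1-tanhHalf (suc N)
    Q = invPow1-tanhHalf N

  divT-expM1*expP1≈two*expS*divT-sinhS : divT expM1 *S expP1 ≈ constS two *S (expS *S divT sinhS)
  divT-expM1*expP1≈two*expS*divT-sinhS = begin≈
    divT expM1 *S expP1                     ≈⟨ ≈-sym (divT-*ˡ expM1 expP1 expM1-0) ⟩
    divT (expM1 *S expP1)                   ≈⟨ divT-cong expM1*expP1≈two*expS*sinhS ⟩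
    divT (constS two *S (expS *S sinhS))    ≈⟨ divT-*ʳ (constS two) (expS *S sinhS) refl ⟩
    constS two *S divT (expS *S sinhS)      ≈⟨ *S-congˡ (constS two) (divT-*ʳ expS sinhS refl) ⟩
    constS two *S (expS *S divT sinhS)      ∎≈

  module _ (n r : ℕ) where
    private
      N : ℕ
      N = n ℕ.+ r
      W E Eʳ S' : PS
      W = expP1
      E = expM1
      Eʳ = powS expM1 r
      S' = divT sinhS

    tanhHalfPow*invPow1-tanhHalf≈ :
      powS tanhHalfS (suc r) *S invPow1-tanhHalf N ≈ (½ ^ℚ suc N) ·S (powS E (suc r) *S powS W n)
    tanhHalfPow*invPow1-tanhHalf≈ = begin≈
      powS tanhHalfS (suc r) *S invPow1-tanhHalf N
        ≈⟨ *S-congˡ (powS tanhHalfS (suc r)) (invPow1-tanhHalf≈ N) ⟩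
      powS tanhHalfS (suc r) *S ((½ ^ℚ suc N) ·S powS W (suc N))
        ≈⟨ *S-·S (½ ^ℚ suc N) (powS tanhHalfS (suc r)) (powS W (suc N)) ⟩
      (½ ^ℚ suc N) ·S (powS tanhHalfS (suc r) *S powS W (suc N))
        ≈⟨ ·S-cong (½ ^ℚ suc N) (*S-congˡ (powS tanhHalfS (suc r)) Wᴺ⁺¹≈Wʳ⁺¹*Wⁿ) ⟩
      (½ ^ℚ suc N) ·S (powS tanhHalfS (suc r) *S (powS W (suc r) *S powS W n))
        ≈⟨ ·S-cong (½ ^ℚ suc N) (≈-trans (≈-sym (*S-assoc (powS tanhHalfS (suc r)) (powS W (suc r)) (powS W n)))
                                         (*S-congʳ (powS W n) tanhʳ⁺¹*Wʳ⁺¹≈Eʳ⁺¹)) ⟩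
      (½ ^ℚ suc N) ·S (powS E (suc r) *S powS W n) ∎≈
      where
      Wᴺ⁺¹≈Wʳ⁺¹*Wⁿ : powS W (suc N) ≈ powS W (suc r) *S powS W n
      Wᴺ⁺¹≈Wʳ⁺¹*Wⁿ k = trans (cong (λ x → powS W (suc x) k) (ℕ.+-comm n r)) (powS-+ W (suc r) n k)
      tanhʳ⁺¹*Wʳ⁺¹≈Eʳ⁺¹ : powS tanhHalfS (suc r) *S powS W (suc r) ≈ powS E (suc r)
      tanhʳ⁺¹*Wʳ⁺¹≈Eʳ⁺¹ = ≈-trans (≈-sym (powS-* tanhHalfS W (suc r))) (powS-cong (suc r) tanhHalf*expP1≈expM1)

    Φ-expM1Pow*expP1Pow : Φ n (powS E (suc r) *S powS W n) ≈ constS two *S expExpM1Pow r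
    Φ-expM1Pow*expP1Pow = begin≈
      P *S (divT ((E *S Eʳ) *S powS W n) *S invS S')
        ≈⟨ *S-congˡ P (*S-congʳ (invS S') (≈-trans (divT-cong (*S-assoc E Eʳ (powS W n)))
                                                   (divT-*ˡ E (Eʳ *S powS W n) expM1-0))) ⟩
      P *S ((divT E *S (Eʳ *S powS W n)) *S invS S')
        ≈⟨ S.solve 5 (λ P dE Eʳ Wⁿ S'⁻¹ → P S.:* ((dE S.:* (Eʳ S.:* Wⁿ)) S.:* S'⁻¹)
                     S.:= (P S.:* Wⁿ) S.:* ((dE S.:* Eʳ) S.:* S'⁻¹))
             ≈-refl P (divT E) Eʳ (powS W n) (invS S') ⟩
      (P *S powS W n) *S ((divT E *S Eʳ) *S invS S')
        ≈⟨ *S-congʳ ((divT E *S Eʳ) *S invS S') (expP1Pow1m*powS-expP1≈expP1 n) ⟩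
      W *S ((divT E *S Eʳ) *S invS S')
        ≈⟨ S.solve 4 (λ W dE Eʳ S'⁻¹ → W S.:* ((dE S.:* Eʳ) S.:* S'⁻¹) S.:= ((dE S.:* W) S.:* Eʳ) S.:* S'⁻¹)
             ≈-refl W (divT E) Eʳ (invS S') ⟩
      ((divT E *S W) *S Eʳ) *S invS S'
        ≈⟨ *S-congʳ (invS S') (*S-congʳ Eʳ divT-expM1*expP1≈two*expS*divT-sinhS) ⟩
      ((constS two *S (expS *S S')) *S Eʳ) *S invS S'
        ≈⟨ S.solve 5 (λ T e S' Eʳ S'⁻¹ → ((T S.:* (e S.:* S')) S.:* Eʳ) S.:* S'⁻¹
                     S.:= (T S.:* (e S.:* Eʳ)) S.:* (S' S.:* S'⁻¹))
             ≈-refl (constS two) expS S' Eʳ (invS S') ⟩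
      (constS two *S expExpM1Pow r) *S (S' *S invS S')
        ≈⟨ ≈-trans (*S-congˡ (constS two *S expExpM1Pow r) (*S-inverseʳ S')) (*S-identityʳ _) ⟩
      constS two *S expExpM1Pow r ∎≈
      where
      P : PS
      P = expP1Pow1m n

    Φ-liTerm : Φ n (powS tanhHalfS (suc r) *S invPow1-tanhHalf N) ≈ (½ ^ℚ N) ·S expExpM1Pow r
    Φ-liTerm = begin≈
      Φ n (powS tanhHalfS (suc r) *S invPow1-tanhHalf N)
        ≈⟨ Φ-cong n tanhHalfPow*invPow1-tanhHalf≈ ⟩
      Φ n ((½ ^ℚ suc N) ·S (powS E (suc r) *S powS W n))
        ≈⟨ Φ-·S n (½ ^ℚ suc N) (powS E (suc r) *S powS W n) ⟩
      (½ ^ℚ suc N) ·S Φ n (powS E (suc r) *S powS W n)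
        ≈⟨ ·S-cong (½ ^ℚ suc N) (≈-trans Φ-expM1Pow*expP1Pow (≈-sym (·S≈constS-*S two (expExpM1Pow r)))) ⟩
      (½ ^ℚ suc N) ·S (two ·S expExpM1Pow r)
        ≈⟨ ·S-·S (½ ^ℚ suc N) two (expExpM1Pow r) ⟩
      (½ ^ℚ suc N * two) ·S expExpM1Pow r
        ≈⟨ (λ k → cong (_* expExpM1Pow r k) ½^[1+N]*two≡½^N) ⟩
      (½ ^ℚ N) ·S expExpM1Pow r ∎≈
      where
      ½^[1+N]*two≡½^N : ½ ^ℚ suc N * two ≡ ½ ^ℚ N
      ½^[1+N]*two≡½^N = begin
        ½ * ½ ^ℚ N * two     ≡⟨ solve 3 (λ h p t → h :* p :* t := (h :* t) :* p) refl ½ (½ ^ℚ N) two ⟩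
        (½ * two) * ½ ^ℚ N   ≡⟨ *-identityˡ (½ ^ℚ N) ⟩
        ½ ^ℚ N               ∎

  compose-·S-sumS : ∀ c L (w : ℕ → ℚ) (g : ℕ → PS) u →
                    compose (c ·S sumS L (λ r → w r ·S g r)) u ≈ c ·S sumS L (λ r → w r ·S compose (g r) u)
  compose-·S-sumS c L w g u =
    ≈-trans (compose-·S c (sumS L (λ r → w r ·S g r)) u)
            (·S-cong c (≈-trans (compose-sumS L (λ r → w r ·S g r) u)
                                (sumS-cong L (λ r → compose-·S (w r) (g r) u))))

  Φ-·S-sumS : ∀ n c L (w : ℕ → ℚ) (g : ℕ → PS) →
              Φ n (c ·S sumS L (λ r → w r ·S g r)) ≈ c ·S sumS L (λ r → w r ·S Φ n (g r))
  Φ-·S-sumS n c L w g =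
    ≈-trans (Φ-·S n c (sumS L (λ r → w r ·S g r)))
            (·S-cong c (≈-trans (Φ-sumS n L (λ r → w r ·S g r))
                                (sumS-cong L (λ r → Φ-·S n (w r) (g r)))))

  module _ (n : ℕ) where

    stirlingGen : ℕ → PS
    stirlingGen l = sumS n (λ j → ι (stirling1 n j) ·S polycscF (l ℕ.+ j) n)

    stirlingGen≈ : ∀ l →
      stirlingGen l ≈ ι (l !) ·S sumS l (λ r → weight n l r ·S ((½ ^ℚ (n ℕ.+ r)) ·S expExpM1Pow r))
    stirlingGen≈ l = begin≈
      sumS n (λ j → ι (stirling1 n j) ·S Φ n (LiS (l ℕ.+ j) Z))
        ≈⟨ ≈-sym (≈-trans (Φ-sumS n n (λ j → ι (stirling1 n j) ·S LiS (l ℕ.+ j) Z))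
                          (sumS-cong n (λ j → Φ-·S n (ι (stirling1 n j)) (LiS (l ℕ.+ j) Z)))) ⟩
      Φ n (sumS n (λ j → ι (stirling1 n j) ·S LiS (l ℕ.+ j) Z))
        ≈⟨ Φ-cong n (≈-sym (≈-trans (compose-sumS n (λ j → ι (stirling1 n j) ·S liCoeff (l ℕ.+ j)) Z)
                                    (sumS-cong n (λ j → compose-·S (ι (stirling1 n j)) (liCoeff (l ℕ.+ j)) Z)))) ⟩
      Φ n (compose (stirlingLi n l) Z)
        ≈⟨ Φ-cong n (≈-trans (compose-congˡ Z (stirlingLi≈ n l))
                             (compose-·S-sumS (ι (l !)) l (weight n l) (liTerm n) Z)) ⟩
      Φ n (ι (l !) ·S sumS l (λ r → weight n l r ·S compose (liTerm n r) Z))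
        ≈⟨ Φ-·S-sumS n (ι (l !)) l (weight n l) (λ r → compose (liTerm n r) Z) ⟩
      ι (l !) ·S sumS l (λ r → weight n l r ·S Φ n (compose (liTerm n r) Z))
        ≈⟨ ·S-cong (ι (l !)) (sumS-cong l (λ r → ·S-cong (weight n l r) (≈-trans
             (Φ-cong n (compose-powS-X*S (suc r) (negBinomS (n ℕ.+ r)) Z tanhHalf0≡0)) (Φ-liTerm n r)))) ⟩
      ι (l !) ·S sumS l (λ r → weight n l r ·S ((½ ^ℚ (n ℕ.+ r)) ·S expExpM1Pow r)) ∎≈
      where
      Z : PS
      Z = tanhHalfS

  -- Symmetry at even orders

  pairingWeight : ℕ → ℕ → ℚ
  pairingWeight n r = ι ((n ℕ.+ r) !) * expS r * ½ ^ℚ (n ℕ.+ r)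

  pairing : ℕ → ℕ → ℕ → ℚ
  pairing n a b = sumTo (a ℕ.+ b) (λ r → expExpM1Pow r a * expExpM1Pow r b * pairingWeight n r)

  pairing-comm : ∀ n a b → pairing n a b ≡ pairing n b a
  pairing-comm n a b =
    trans (cong (λ x → sumTo x (λ r → expExpM1Pow r a * expExpM1Pow r b * pairingWeight n r)) (ℕ.+-comm a b))
          (sumTo-cong (b ℕ.+ a) (λ r _ → cong (_* pairingWeight n r) (*-comm (expExpM1Pow r a) (expExpM1Pow r b))))

  expExpM1Pow-hasOrder≥ : ∀ r → expExpM1Pow r hasOrder≥ r
  expExpM1Pow-hasOrder≥ r = *S-hasOrder≥ {expS} {powS expM1 r} {0} {r} (λ k ()) (powS-hasOrder≥ {expM1} expM1-0 r)

  -1^ℚ-even : ∀ m → (- 1ℚ) ^ℚ (2 ℕ.* m) ≡ 1ℚ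
  -1^ℚ-even m = begin
    (- 1ℚ) ^ℚ (2 ℕ.* m)            ≡⟨ cong ((- 1ℚ) ^ℚ_) (cong (m ℕ.+_) (ℕ.+-identityʳ m)) ⟩
    (- 1ℚ) ^ℚ (m ℕ.+ m)            ≡⟨ ^ℚ-+ (- 1ℚ) m m ⟩
    (- 1ℚ) ^ℚ m * (- 1ℚ) ^ℚ m      ≡⟨ sym (^ℚ-* (- 1ℚ) (- 1ℚ) m) ⟩
    ((- 1ℚ) * (- 1ℚ)) ^ℚ m         ≡⟨⟩
    1ℚ ^ℚ m                        ≡⟨ 1^ℚ m ⟩
    1ℚ                             ∎

  polycscGen-even : ∀ l n m → polycscGen l n (2 ℕ.* m) ≡ polycscF l n (2 ℕ.* m)
  polycscGen-even l n m = begin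
    ½ * (F + (- 1ℚ) ^ℚ (2 ℕ.* m) * F)
      ≡⟨ cong (λ y → ½ * (F + y * F)) (-1^ℚ-even m) ⟩
    ½ * (F + 1ℚ * F)
      ≡⟨ solve 2 (λ h x → h :* (x :+ con 1ℚ :* x) := (h :* (con 1ℚ :+ con 1ℚ)) :* x) refl ½ F ⟩
    (½ * (1ℚ + 1ℚ)) * F
      ≡⟨ *-identityˡ F ⟩
    F ∎
    where
    F : ℚ
    F = polycscF l n (2 ℕ.* m)

  symDClosedForm : ℕ → ℕ → ℕ → ℚ
  symDClosedForm n a b = ι (a !) * ι (b !) * pairing n a b

  symDClosedForm-comm : ∀ n a b → symDClosedForm n a b ≡ symDClosedForm n b a
  symDClosedForm-comm n a b = cong₂ _*_ (*-comm (ι (a !)) (ι (b !))) (pairing-comm n a b)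

  symD-even≡symDClosedForm : ∀ l n m → symD l n (2 ℕ.* m) ≡ symDClosedForm n l (2 ℕ.* m)
  symD-even≡symDClosedForm l n m = begin
    sumTo n (λ j → ι (stirling1 n j) * (ι (M !) * polycscGen (l ℕ.+ j) n M))
      ≡⟨ sumTo-cong n (λ j _ → trans (cong (λ y → ι (stirling1 n j) * (ι (M !) * y)) (polycscGen-even (l ℕ.+ j) n m))
                                     (solve 3 (λ a b c → a :* (b :* c) := b :* (a :* c)) refl
                                            (ι (stirling1 n j)) (ι (M !)) (polycscF (l ℕ.+ j) n M))) ⟩
    sumTo n (λ j → ι (M !) * (ι (stirling1 n j) * polycscF (l ℕ.+ j) n M))
      ≡⟨ sym (sumTo-*ˡ n (ι (M !)) _) ⟩
    ι (M !) * stirlingGen n l M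
      ≡⟨ cong (ι (M !) *_) (stirlingGen≈ n l M) ⟩
    ι (M !) * (ι (l !) * sumTo l (λ r → weight n l r * (½ ^ℚ (n ℕ.+ r) * expExpM1Pow r M)))
      ≡⟨ cong (λ y → ι (M !) * (ι (l !) * y)) (trans (sumTo-cong l (λ r _ → regroup r))
                                                     (sym (sumTo-extend _ (ℕ.m≤m+n l M) vanishing))) ⟩
    ι (M !) * (ι (l !) * pairing n l M)
      ≡⟨ solve 3 (λ a b c → a :* (b :* c) := b :* a :* c) refl (ι (M !)) (ι (l !)) (pairing n l M) ⟩
    symDClosedForm n l M ∎
    where
    M : ℕ
    M = 2 ℕ.* m
    regroup : ∀ r → weight n l r * (½ ^ℚ (n ℕ.+ r) * expExpM1Pow r M)
                    ≡ expExpM1Pow r l * expExpM1Pow r M * pairingWeight n r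
    regroup r = solve 5 (λ a b c h d → (a :* b :* c) :* (h :* d) := a :* d :* (b :* c :* h)) refl
                        (expExpM1Pow r l) (ι ((n ℕ.+ r) !)) (expS r) (½ ^ℚ (n ℕ.+ r)) (expExpM1Pow r M)
    vanishing : ∀ r → l < r → r ≤ l ℕ.+ M → expExpM1Pow r l * expExpM1Pow r M * pairingWeight n r ≡ 0ℚ
    vanishing r l<r _ = begin
      expExpM1Pow r l * expExpM1Pow r M * pairingWeight n r  ≡⟨ cong (λ y → y * expExpM1Pow r M * pairingWeight n r)
                                                                     (expExpM1Pow-hasOrder≥ r l l<r) ⟩
      0ℚ * expExpM1Pow r M * pairingWeight n r               ≡⟨ cong (_* pairingWeight n r) (*-zeroˡ (expExpM1Pow r M)) ⟩
      0ℚ * pairingWeight n r                                 ≡⟨ *-zeroˡ (pairingWeight n r) ⟩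
      0ℚ                                                     ∎

open import Data.Nat using (_*_)

theorem4p6 : (l m n : ℕ) → symD (2 * l) n (2 * m) ≡ symD (2 * m) n (2 * l)
theorem4p6 l m n = begin
  symD (2 * l) n (2 * m)                ≡⟨ symD-even≡symDClosedForm (2 * l) n m ⟩
  symDClosedForm n (2 * l) (2 * m)      ≡⟨ symDClosedForm-comm n (2 * l) (2 * m) ⟩
  symDClosedForm n (2 * m) (2 * l)      ≡⟨ sym (symD-even≡symDClosedForm (2 * m) n l) ⟩
  symD (2 * m) n (2 * l)                ∎
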